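{- For all $n \geq 1$, the map $\Lambda_{\mathrm{poset}}$ is a bijection from $\mathcal{P}_n$ to $\mathcal{T}_n$, and its inverse is $\Xi_{\mathrm{poset}}$.
   Context: For a finite set $S = \{x_1 < \cdots < x_n\} \subset \mathbb{R}$, define the partial order $\preceq_S$ on $[n]=\{1,\ldots,n\}$ by $i \prec_S j$ iff $x_i + 1 < x_j$. A poset is a unit interval poset if it is isomorphic to $([n], \preceq_S)$ for some such $S$ (a starting set). $\mathcal{P}_n$ denotes the set of unit interval posets with $n$ elements (up to isomorphism). A plane tree is a rooted tree in which the children of each node are ordered from left to right; $\mathcal{T}_n$ is the set of plane trees with $n$ non-root nodes. The depth $d(u)$ of a node is its distance to the root. $\Lambda_{\mathrm{poset}}$: given $P = ([n], \preceq_S)$ with $S = \{x_1 < \cdots < x_n\}$, set $x_0 = x_1 - 2$ and take nodes $v_0, v_1, \ldots, v_n$ with root $v_0$. For $i \in [n]$, the parent of $v_i$ is $v_j$ where $j \in \{0,1,\ldots,n\}$ is the largest index with $x_j + 1 < x_i$. Children of a common node are ordered from left to right by decreasing index. This tree depends only on $\preceq_S$ and is $\Lambda_{\mathrm{poset}}(P)$. $\Xi_{\mathrm{poset}}$: given $T \in \mathcal{T}_n$ with maximal arity $m$ (maximal number of children of a node), for a non-root node $w$ let $c(w)=i$ if $w$ is the $i$-th child of its parent counted from right to left. For a non-root node $u$ with root-to-$u$ path $u_0, u_1, \ldots, u_{d(u)} = u$, set $x_u = d(u) + \sum_{i=1}^{d(u)} c(u_i)(m+2)^{ -i}$. Let $S$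 be the set of all $x_u$ for non-root $u$; then $\Xi_{\mathrm{poset}}(T) = ([n], \preceq_S)$.
   Formalization: Starting sets S are finite subsets of ℚ rather than of ℝ. -}

module Defs where

open import Data.Nat as ℕ using (ℕ; zero; suc; _⊔_; _∸_)
open import Data.Nat.Properties using () renaming (_≟_ to _≟ℕ_)
open import Data.Integer using (+_)
open import Data.Rational using (ℚ; _+_; _-_; _*_; _<_; 0ℚ; 1ℚ; _/_)
open import Data.Rational.Properties using (_<?_; ≤-decTotalOrder)
open import Data.List using (List; []; _∷_; length; map; filter; upTo; reverse; foldr; _++_; lookup)
open import Data.List.Relation.Unary.Linked using (Linked)
open import Data.List.Sort.InsertionSort ≤-decTotalOrder using (sort)
open import Data.Fin using (Fin)
open import Data.Product using (Σ; _×_)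
open import Data.Sum using (_⊎_)
open import Function.Bundles using (_↔_; Inverse)
open import Relation.Binary.PropositionalEquality using (_≡_)

-- A starting set S = {x_1 < ... < x_n} is represented by the strictly
-- increasing list [x_1, ..., x_n] of rationals.
StartingSet : List ℚ → Set
StartingSet S = Linked _<_ S

Prec : (S : List ℚ) → Fin (length S) → Fin (length S) → Set
Prec S i j = (i ≡ j) ⊎ (lookup S i + 1ℚ < lookup S j)

PosetIso : List ℚ → List ℚ → Set
PosetIso S S' =
  Σ (Fin (length S) ↔ Fin (length S')) λ f →
    ∀ i j → (Prec S i j → Prec S' (Inverse.to f i) (Inverse.to f j))
          × (Prec S' (Inverse.to f i) (Inverse.to f j) → Prec S i j)

-- A plane tree: a node with an ordered (left to right) list of subtrees.
data Tree : Set where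
  node : List Tree → Tree

-- number of non-root nodes
mutual
  size : Tree → ℕ
  size (node ts) = sizes ts

  sizes : List Tree → ℕ
  sizes []       = 0
  sizes (t ∷ ts) = suc (size t) ℕ.+ sizes ts

mutual
  maxArity : Tree → ℕ
  maxArity (node ts) = length ts ⊔ maxArities ts

  maxArities : List Tree → ℕ
  maxArities []       = 0
  maxArities (t ∷ ts) = maxArity t ⊔ maxArities ts

nth : List ℚ → ℕ → ℚ
nth []       _       = 0ℚ
nth (x ∷ xs) zero    = x
nth (x ∷ xs) (suc i) = nth xs i

head0 : List ℚ → ℚ
head0 []      = 0ℚ
head0 (x ∷ _) = x

xval : List ℚ → ℕ → ℚ
xval S zero    = head0 S - (+ 2 / 1)
xval S (suc i) = nth S i

parentIdx : List ℚ → ℕ → ℕ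
parentIdx S i =
  foldr _⊔_ 0 (filter (λ j → (xval S j + 1ℚ) <? xval S i) (upTo (suc (length S))))

-- children of v_j, ordered left to right by decreasing index
childrenIdx : List ℚ → ℕ → List ℕ
childrenIdx S j =
  reverse (filter (λ i → parentIdx S i ≟ℕ j) (map suc (upTo (length S))))

-- the subtree rooted at v_j (fuel bounds the depth; parents have smaller
-- indices than children, so fuel n + 1 suffices)
buildFrom : List ℚ → ℕ → ℕ → Tree
buildFrom S zero    j = node []
buildFrom S (suc f) j = node (map (buildFrom S f) (childrenIdx S j))

Λposet : List ℚ → Tree
Λposet S = buildFrom S (suc (length S)) 0

powℚ : ℚ → ℕ → ℚ
powℚ w zero    = 1ℚ
powℚ w (suc k) = w * powℚ w k

-- w = (m+2)^{-1}.  For a node at depth d whose path sum is s, list the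
-- values x_u of all its strict descendants u.  In xsList, k is the
-- right-to-left position c of the first child in the list.
mutual
  xsNode : ℚ → ℕ → ℚ → Tree → List ℚ
  xsNode w d s (node ts) = xsList w d s (length ts) ts

  xsList : ℚ → ℕ → ℚ → ℕ → List Tree → List ℚ
  xsList w d s k []       = []
  xsList w d s k (t ∷ ts) =
    let s' = s + ((+ k / 1) * powℚ w (suc d)) in
    ((+ (suc d) / 1) + s') ∷ (xsNode w (suc d) s' t ++ xsList w d s (k ∸ 1) ts)

Ξposet : Tree → List ℚ
Ξposet T = sort (xsNode (+ 1 / suc (suc (maxArity T))) 0 0ℚ T)

{-# OPTIONS --safe #-}
-- For a starting set x₁ < ⋯ < xₙ (and x₀ = x₁ − 2) let p(i) be the largest j with x_j + 1 < x_i, the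
-- parent of v_i in Λ. Since x is increasing, j ≤ p(i) exactly when x_j + 1 < x_i: so p(i) is the number
-- of elements below i in ⪯_S, p is weakly increasing with p(i) < i, and p determines ⪯_S. An isomorphism
-- preserves these down-degrees, and a monotone p is determined by their multiset, so Λ is well defined.
-- Monotonicity makes the children of j the consecutive indices c(j) + 1, …, c(j + 1), where c(j) counts the
-- i with p(i) < j. Hence breadth-first search in Λ(S), visiting children right to left, meets v₀, …, vₙ in
-- this order: Λ(S) has n non-root nodes, and the queue lengths give back c and thus p, so Λ is injective.
-- In Ξ(T) a node whose root path has right-to-left child positions c₁ … c_d gets x = d + N / B^d, where N
-- has base-B digits c₁ … c_d and B = m + 2 exceeds the maximal arity m. So x-values compare like (d , N)
-- lexicographically, and x + 1 is the value of (d + 1 , N B), which precedes exactly the children of the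
-- node; thus the last node lying below a child is its parent, and Λ(Ξ(T)) = T. Finally Λ(Ξ(Λ(S))) = Λ(S)
-- and injectivity give Ξ(Λ(S)) ≅ S.
module Submission where

open import Defs
open import Data.Nat hiding (_/_)
open import Data.Nat.Properties
import Data.Integer as ℤ
import Data.Integer.Properties as ℤₚ
open import Data.Rational as ℚ using (ℚ; 0ℚ; 1ℚ; _/_; toℚᵘ)
import Data.Rational.Properties as ℚₚ
open import Data.Rational.Unnormalised as ℚᵘ using (mkℚᵘ; *≡*; *<*)
import Data.Rational.Unnormalised.Properties as ℚᵘₚ
open import Data.Rational.Solver using (module +-*-Solver)
open import Data.Fin as Fin using (Fin; toℕ)
import Data.Fin.Properties as Finₚ
import Data.Fin.Permutation as Perm
open import Data.List using (List; []; _∷_; _++_; map; length; filter; upTo; applyUpTo; reverse; lookup)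
open import Data.List.Properties
  using ( map-∘; map-cong; map-cong-local; map-++; map-applyUpTo; length-map; length-++; length-filter
        ; filter-none; filter-all; reverse-map; reverse-involutive; unfold-reverse; foldr-preservesᵇ; foldr-preservesᵒ)
open import Data.List.Membership.Propositional using (_∈_; find; lose)
open import Data.List.Membership.Propositional.Properties
  using (∈-filter⁺; ∈-filter⁻; ∈-upTo⁺; ∈-upTo⁻; ∈-map⁺; ∈-map⁻; ∈-++⁻; ∈-++⁺ˡ; ∈-++⁺ʳ)
open import Data.List.Relation.Unary.Any as Any using (Any; here; there)
import Data.List.Relation.Unary.Any.Properties as Any
open import Data.List.Relation.Unary.All as All using (All; []; _∷_)
import Data.List.Relation.Unary.All.Properties as All
open import Data.List.Relation.Unary.AllPairs using (AllPairs; []; _∷_)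
import Data.List.Relation.Unary.AllPairs.Properties as AllPairs
open import Data.List.Relation.Unary.Linked as Linked using (Linked; []; [-]; _∷_)
import Data.List.Relation.Unary.Linked.Properties as Linked
open import Data.List.Relation.Unary.Unique.Propositional using (Unique)
import Data.List.Relation.Unary.Unique.Propositional.Properties as Unique
open import Data.List.Relation.Binary.Permutation.Propositional using (_↭_; ↭-sym; ↭⇒↭ₛ)
open import Data.List.Relation.Binary.Permutation.Propositional.Properties using (∈-resp-↭; ↭-length)
import Data.List.Relation.Binary.Permutation.Setoid.Properties as Permutationₛ
open import Data.List.Sort.InsertionSort.Properties ℚₚ.≤-decTotalOrder using (sort-↭; sort-↗)
open import Data.Product using (_×_; _,_; proj₁; proj₂; ∃-syntax)
open import Data.Product.Relation.Binary.Lex.Strict using (×-Lex; ×-compare)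
open import Data.Sum using (_⊎_; inj₁; inj₂; [_,_]′)
open import Data.Empty using (⊥; ⊥-elim)
open import Function using (_∘_; flip)
open import Function.Bundles using (Inverse)
open import Level using (0ℓ)
open import Relation.Nullary using (Dec; yes; no; ¬_)
open import Relation.Unary using (Pred; Decidable)
open import Relation.Binary.Definitions using (Transitive; tri<; tri≈; tri>)
open import Relation.Binary.PropositionalEquality hiding ([_])
open import Algebra.Properties.CommutativeMonoid.Sum +-0-commutativeMonoid using (sum-syntax; sum-cong-≗; ∑-permute)


-- Lists

range : ℕ → ℕ → List ℕ
range a zero    = []
range a (suc k) = a ∷ range (suc a) k

map-suc-range : ∀ a k → map suc (range a k) ≡ range (suc a) k
map-suc-range a zero    = refl
map-suc-range a (suc k) = cong (suc a ∷_) (map-suc-range (suc a) k)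

applyUpTo≡map-range : ∀ {A : Set} (f : ℕ → A) n → applyUpTo f n ≡ map f (range 0 n)
applyUpTo≡map-range f zero    = refl
applyUpTo≡map-range f (suc n) = cong (f 0 ∷_) (begin
  applyUpTo (f ∘ suc) n         ≡⟨ applyUpTo≡map-range (f ∘ suc) n ⟩
  map (f ∘ suc) (range 0 n)     ≡⟨ map-∘ (range 0 n) ⟩
  map f (map suc (range 0 n))   ≡⟨ cong (map f) (map-suc-range 0 n) ⟩
  map f (range 1 n)             ∎)
  where open ≡-Reasoning

map-suc-upTo : ∀ n → map suc (upTo n) ≡ range 1 n
map-suc-upTo n = trans (map-applyUpTo _ suc n) (trans (applyUpTo≡map-range suc n) (map-suc-range 0 n))

length-range : ∀ a k → length (range a k) ≡ k
length-range a zero    = refl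
length-range a (suc k) = cong suc (length-range (suc a) k)

∈-range⁻ : ∀ {i} a k → i ∈ range a k → a ≤ i × i < a + k
∈-range⁻ a (suc k) (here refl) = ≤-refl , m<m+n a z<s
∈-range⁻ {i} a (suc k) (there i∈) with ∈-range⁻ (suc a) k i∈
... | a<i , i<a+k = <⇒≤ a<i , subst (i <_) (sym (+-suc a k)) i<a+k

∈-range⁺ : ∀ {i} a k → a ≤ i → i < a + k → i ∈ range a k
∈-range⁺ {i} a zero    a≤i i<a+0 = ⊥-elim (<-irrefl refl (≤-<-trans a≤i (subst (i <_) (+-identityʳ a) i<a+0)))
∈-range⁺ {i} a (suc k) a≤i i<a+k with a ≟ i
... | yes refl = here refl
... | no  a≢i  = there (∈-range⁺ (suc a) k (≤∧≢⇒< a≤i a≢i) (subst (i <_) (+-suc a k) i<a+k))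

range-++ : ∀ a k l → range a k ++ range (a + k) l ≡ range a (k + l)
range-++ a zero    l = cong (λ b → range b l) (+-identityʳ a)
range-++ a (suc k) l = cong (a ∷_) (trans (cong (λ b → range (suc a) k ++ range b l) (+-suc a k))
                                          (range-++ (suc a) k l))

range-↗ : ∀ a k → Linked _<_ (range a k)
range-↗ a zero          = []
range-↗ a (suc zero)    = [-]
range-↗ a (suc (suc k)) = n<1+n a ∷ range-↗ (suc a) (suc k)

module _ {A : Set} {P Q : Pred A 0ℓ} (P? : Decidable P) (Q? : Decidable Q) where

  filter-cong-∈ : ∀ xs → (∀ {x} → x ∈ xs → (P x → Q x) × (Q x → P x)) → filter P? xs ≡ filter Q? xs
  filter-cong-∈ []       P⇔Q = refl
  filter-cong-∈ (x ∷ xs) P⇔Q with P? x | Q? x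
  ... | yes px | yes _  = cong (x ∷_) (filter-cong-∈ xs (P⇔Q ∘ there))
  ... | yes px | no ¬qx = ⊥-elim (¬qx (proj₁ (P⇔Q (here refl)) px))
  ... | no ¬px | yes qx = ⊥-elim (¬px (proj₂ (P⇔Q (here refl)) qx))
  ... | no _   | no _   = filter-cong-∈ xs (P⇔Q ∘ there)

  length-filter-mono : ∀ xs → (∀ {x} → P x → Q x) → length (filter P? xs) ≤ length (filter Q? xs)
  length-filter-mono []       P⇒Q = z≤n
  length-filter-mono (x ∷ xs) P⇒Q with P? x | Q? x
  ... | yes _  | yes _  = s≤s (length-filter-mono xs P⇒Q)
  ... | yes px | no ¬qx = ⊥-elim (¬qx (P⇒Q px))
  ... | no _   | yes _  = m≤n⇒m≤1+n (length-filter-mono xs P⇒Q)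
  ... | no _   | no _   = length-filter-mono xs P⇒Q

filter-range-downClosed : ∀ {Q : Pred ℕ 0ℓ} (Q? : Decidable Q) a k →
  (∀ {i j} → a ≤ i → i ≤ j → j < a + k → Q j → Q i) →
  filter Q? (range a k) ≡ range a (length (filter Q? (range a k)))
filter-range-downClosed Q? a zero    down = refl
filter-range-downClosed {Q} Q? a (suc k) down with Q? a
... | yes _  = cong (a ∷_) (filter-range-downClosed Q? (suc a) k down′)
  where
  down′ : ∀ {i j} → suc a ≤ i → i ≤ j → j < suc a + k → Q j → Q i
  down′ {j = j} a<i i≤j j<a+k = down (<⇒≤ a<i) i≤j (subst (j <_) (sym (+-suc a k)) j<a+k)
... | no ¬qa = trans none (cong (range a ∘ length) (sym none))
  where
  none : filter Q? (range (suc a) k) ≡ []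
  none = filter-none Q? (All.tabulate λ {i} i∈ → let a<i , i<a+k = ∈-range⁻ (suc a) k i∈ in
    ¬qa ∘ down ≤-refl (<⇒≤ a<i) (subst (i <_) (sym (+-suc a k)) i<a+k))

module _ {A : Set} {_≺_ : A → A → Set} (≺-trans : Transitive _≺_) (≺-irrefl : ∀ {x} → ¬ x ≺ x) where

  ↗-head≺ : ∀ {x z xs} → Linked _≺_ (x ∷ xs) → z ∈ xs → x ≺ z
  ↗-head≺ (x≺y ∷ xs↗) = All.lookup (Linked.Linked⇒All ≺-trans x≺y xs↗)

  strictlySorted-≡ : ∀ {xs ys} → Linked _≺_ xs → Linked _≺_ ys →
    (∀ {z} → z ∈ xs → z ∈ ys) → (∀ {z} → z ∈ ys → z ∈ xs) → xs ≡ ys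
  strictlySorted-≡ {[]}     {[]}     _ _ _ _ = refl
  strictlySorted-≡ {[]}     {y ∷ ys} _ _ _ ⊇ with () ← ⊇ (here refl)
  strictlySorted-≡ {x ∷ xs} {[]}     _ _ ⊆ _ with () ← ⊆ (here refl)
  strictlySorted-≡ {x ∷ xs} {y ∷ ys} xs↗ ys↗ ⊆ ⊇ =
    cong₂ _∷_ x≡y (strictlySorted-≡ (Linked.tail xs↗) (Linked.tail ys↗) ⊆′ ⊇′)
    where
    x≡y : x ≡ y
    x≡y with ⊆ (here refl) | ⊇ (here refl)
    ... | here x≡y   | _          = x≡y
    ... | there _    | here y≡x   = sym y≡x
    ... | there x∈ys | there y∈xs = ⊥-elim (≺-irrefl (≺-trans (↗-head≺ xs↗ y∈xs) (↗-head≺ ys↗ x∈ys)))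
    ⊆′ : ∀ {z} → z ∈ xs → z ∈ ys
    ⊆′ z∈xs with ⊆ (there z∈xs)
    ... | here refl  = ⊥-elim (≺-irrefl (subst (x ≺_) (sym x≡y) (↗-head≺ xs↗ z∈xs)))
    ... | there z∈ys = z∈ys
    ⊇′ : ∀ {z} → z ∈ ys → z ∈ xs
    ⊇′ z∈ys with ⊇ (there z∈ys)
    ... | here refl  = ⊥-elim (≺-irrefl (subst (y ≺_) x≡y (↗-head≺ ys↗ z∈ys)))
    ... | there z∈xs = z∈xs

∈-∷-++⁻ : ∀ {A : Set} {x y : A} xs {ys} → y ∈ x ∷ (xs ++ ys) → y ≡ x ⊎ y ∈ xs ⊎ y ∈ ys
∈-∷-++⁻ xs (here y≡x) = inj₁ y≡x
∈-∷-++⁻ xs (there y∈) with ∈-++⁻ xs y∈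
... | inj₁ y∈xs = inj₂ (inj₁ y∈xs)
... | inj₂ y∈ys = inj₂ (inj₂ y∈ys)

Unique-resp-↭ : ∀ {A : Set} {xs ys : List A} → xs ↭ ys → Unique xs → Unique ys
Unique-resp-↭ {A} xs↭ys = Permutationₛ.Unique-resp-↭ (setoid A) (↭⇒↭ₛ xs↭ys)

module _ {A B : Set} {P : A → Set} {f : A → B} where

  Unique-map⁺-on : ∀ {xs} → All P xs → (∀ {x y} → P x → P y → f x ≡ f y → x ≡ y) →
                   Unique xs → Unique (map f xs)
  Unique-map⁺-on []         inj []         = []
  Unique-map⁺-on (px ∷ pxs) inj (x∉ ∷ xs!) =
    All.map⁺ (All.zipWith (λ (x≢y , py) fx≡fy → x≢y (inj px py fx≡fy)) (x∉ , pxs)) ∷ Unique-map⁺-on pxs inj xs!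

  Linked-map⁺-on : ∀ {R : A → A → Set} {R′ : B → B → Set} {xs} → All P xs →
    (∀ {x y} → P x → P y → R x y → R′ (f x) (f y)) → Linked R xs → Linked R′ (map f xs)
  Linked-map⁺-on _              mono []          = []
  Linked-map⁺-on _              mono [-]         = [-]
  Linked-map⁺-on (px ∷ py ∷ ps) mono (r ∷ rs) = mono px py r ∷ Linked-map⁺-on (py ∷ ps) mono rs

AllPairs-reverse : ∀ {A : Set} {R : A → A → Set} {xs} → AllPairs R xs → AllPairs (flip R) (reverse xs)
AllPairs-reverse {xs = []}     []       = []
AllPairs-reverse {R = R} {xs = x ∷ xs} (x∼ ∷ xs!) = subst (AllPairs (flip R)) (sym (unfold-reverse x xs))
  (AllPairs.++⁺ (AllPairs-reverse xs!) ([] ∷ []) (All.tabulate λ y∈ → All.lookup x∼ (Any.reverse⁻ y∈) ∷ []))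

Linked-reverse : ∀ {A : Set} {R : A → A → Set} → Transitive R →
                 ∀ {xs} → Linked R xs → Linked (flip R) (reverse xs)
Linked-reverse trans = Linked.AllPairs⇒Linked ∘ AllPairs-reverse ∘ Linked.Linked⇒AllPairs trans

Unique-map-injective : ∀ {A B : Set} (f : A → B) {xs x y} → Unique (map f xs) →
                       x ∈ xs → y ∈ xs → f x ≡ f y → x ≡ y
Unique-map-injective f (_ ∷ _)    (here refl) (here refl) _   = refl
Unique-map-injective f (fx∉ ∷ _)  (here refl) (there y∈)  fx≡ = ⊥-elim (All.lookup fx∉ (∈-map⁺ f y∈) fx≡)
Unique-map-injective f (fy∉ ∷ _)  (there x∈)  (here refl) fx≡ = ⊥-elim (All.lookup fy∉ (∈-map⁺ f x∈) (sym fx≡))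
Unique-map-injective f (_ ∷ fxs!) (there x∈)  (there y∈)  fx≡ = Unique-map-injective f fxs! x∈ y∈ fx≡

indicator : ∀ {A : Set} → Dec A → ℕ
indicator (yes _) = 1
indicator (no _)  = 0

indicator-cong : ∀ {A B : Set} (a? : Dec A) (b? : Dec B) → (A → B) → (B → A) → indicator a? ≡ indicator b?
indicator-cong (yes _) (yes _) _ _ = refl
indicator-cong (yes a) (no ¬b) f _ = ⊥-elim (¬b (f a))
indicator-cong (no ¬a) (yes b) _ g = ⊥-elim (¬a (g b))
indicator-cong (no _)  (no _)  _ _ = refl

module _ {P : Pred ℕ 0ℓ} (P? : Decidable P) where

  length-filter-∷ : ∀ x xs → length (filter P? (x ∷ xs)) ≡ indicator (P? x) + length (filter P? xs)
  length-filter-∷ x xs with P? x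
  ... | yes _ = refl
  ... | no _  = refl

  length-filter-range≡∑ : ∀ a k → length (filter P? (range a k)) ≡ ∑[ i < k ] indicator (P? (a + toℕ i))
  length-filter-range≡∑ a zero    = refl
  length-filter-range≡∑ a (suc k) = begin
    length (filter P? (a ∷ range (suc a) k))
      ≡⟨ length-filter-∷ a (range (suc a) k) ⟩
    indicator (P? a) + length (filter P? (range (suc a) k))
      ≡⟨ cong₂ _+_ (cong (indicator ∘ P?) (sym (+-identityʳ a))) (length-filter-range≡∑ (suc a) k) ⟩
    indicator (P? (a + 0)) + ∑[ i < k ] indicator (P? (suc a + toℕ i))
      ≡⟨ cong (indicator (P? (a + 0)) +_) (sum-cong-≗ {k} λ i → cong (indicator ∘ P?) (sym (+-suc a (toℕ i)))) ⟩
    ∑[ i < suc k ] indicator (P? (a + toℕ i)) ∎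
    where open ≡-Reasoning

filter-<-range : ∀ {v k} → v ≤ k → filter (_<? v) (range 0 k) ≡ range 0 v
filter-<-range {v} {k} v≤k = strictlySorted-≡ <-trans (<-irrefl refl)
  (Linked.filter⁺ (_<? v) <-trans (range-↗ 0 k)) (range-↗ 0 v)
  (λ x∈ → ∈-range⁺ 0 v z≤n (proj₂ (∈-filter⁻ (_<? v) {xs = range 0 k} x∈)))
  (λ x∈ → let x<v = proj₂ (∈-range⁻ 0 v x∈) in ∈-filter⁺ (_<? v) (∈-range⁺ 0 k z≤n (<-≤-trans x<v v≤k)) x<v)

∑-indicator-< : ∀ {v k} → v ≤ k → ∑[ i < k ] indicator (toℕ i <? v) ≡ v
∑-indicator-< {v} {k} v≤k = begin
  ∑[ i < k ] indicator (toℕ i <? v)      ≡⟨ length-filter-range≡∑ (_<? v) 0 k ⟨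
  length (filter (_<? v) (range 0 k))     ≡⟨ cong length (filter-<-range v≤k) ⟩
  length (range 0 v)                      ≡⟨ length-range 0 v ⟩
  v                                       ∎
  where open ≡-Reasoning


-- The plane tree of a parent map

sizes-++ : ∀ ts us → sizes (ts ++ us) ≡ sizes ts + sizes us
sizes-++ []       us = refl
sizes-++ (t ∷ ts) us = trans (cong (suc (size t) +_) (sizes-++ ts us)) (sym (+-assoc (suc (size t)) (sizes ts) (sizes us)))

sizes-reverse : ∀ ts → sizes (reverse ts) ≡ sizes ts
sizes-reverse []       = refl
sizes-reverse (t ∷ ts) = begin
  sizes (reverse (t ∷ ts))          ≡⟨ cong sizes (unfold-reverse t ts) ⟩
  sizes (reverse ts ++ t ∷ [])      ≡⟨ sizes-++ (reverse ts) (t ∷ []) ⟩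
  sizes (reverse ts) + sizes (t ∷ []) ≡⟨ cong₂ _+_ (sizes-reverse ts) (+-identityʳ (suc (size t))) ⟩
  sizes ts + suc (size t)           ≡⟨ +-comm (sizes ts) (suc (size t)) ⟩
  sizes (t ∷ ts)                    ∎
  where open ≡-Reasoning

bfsStep : List Tree → List Tree
bfsStep []            = []
bfsStep (node ts ∷ q) = q ++ reverse ts

bfsQueue : Tree → ℕ → List Tree
bfsQueue t zero    = t ∷ []
bfsQueue t (suc j) = bfsStep (bfsQueue t j)

sizes-bfsStep : ∀ q → sizes (bfsStep q) ≡ pred (sizes q)
sizes-bfsStep []            = refl
sizes-bfsStep (node ts ∷ q) = begin
  sizes (q ++ reverse ts)         ≡⟨ sizes-++ q (reverse ts) ⟩
  sizes q + sizes (reverse ts)    ≡⟨ cong (sizes q +_) (sizes-reverse ts) ⟩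
  sizes q + sizes ts              ≡⟨ +-comm (sizes q) (sizes ts) ⟩
  sizes ts + sizes q              ∎
  where open ≡-Reasoning

sizes-bfsQueue : ∀ t j → sizes (bfsQueue t j) ≡ suc (size t) ∸ j
sizes-bfsQueue t zero    = +-identityʳ (suc (size t))
sizes-bfsQueue t (suc j) = begin
  sizes (bfsStep (bfsQueue t j))  ≡⟨ sizes-bfsStep (bfsQueue t j) ⟩
  pred (sizes (bfsQueue t j))     ≡⟨ cong pred (sizes-bfsQueue t j) ⟩
  pred (suc (size t) ∸ j)         ≡⟨ pred[m∸n]≡m∸[1+n] (suc (size t)) j ⟩
  suc (size t) ∸ suc j            ∎
  where open ≡-Reasoning

module _ (n : ℕ) (p : ℕ → ℕ) where

  childrenOf : ℕ → List ℕ
  childrenOf j = reverse (filter (λ i → p i ≟ j) (range 1 n))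

  growTree : ℕ → ℕ → Tree
  growTree zero    j = node []
  growTree (suc f) j = node (map (growTree f) (childrenOf j))

  #children< : ℕ → ℕ
  #children< j = length (filter (λ i → p i <? j) (range 1 n))

growTree-cong : ∀ {n p p′} → (∀ {i} → 1 ≤ i → i ≤ n → p i ≡ p′ i) →
                ∀ f j → growTree n p f j ≡ growTree n p′ f j
growTree-cong         p≡p′ zero    j = refl
growTree-cong {n} {p} {p′} p≡p′ (suc f) j =
  cong node (trans (map-cong (growTree-cong p≡p′ f) _) (cong (map (growTree n p′ f)) children≡))
  where
  children≡ : childrenOf n p j ≡ childrenOf n p′ j
  children≡ = cong reverse (filter-cong-∈ _ _ (range 1 n) λ i∈ →
    let 1≤i , i<1+n = ∈-range⁻ 1 n i∈ ; pi≡p′i = p≡p′ 1≤i (≤-pred i<1+n) in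
    trans (sym pi≡p′i) , trans pi≡p′i)

record IsParentMap (n : ℕ) (p : ℕ → ℕ) : Set where
  field
    parent<     : ∀ {i} → 1 ≤ i → i ≤ n → p i < i
    parent-mono : ∀ {i i′} → 1 ≤ i → i ≤ i′ → i′ ≤ n → p i ≤ p i′

module ParentMapTree {n p} (isParentMap : IsParentMap n p) where
  open IsParentMap isParentMap

  private
    c : ℕ → ℕ
    c = #children< n p

  parent<-prefix : ∀ j → filter (λ i → p i <? j) (range 1 n) ≡ range 1 (c j)
  parent<-prefix j = filter-range-downClosed (λ i → p i <? j) 1 n
    λ 1≤i i≤i′ i′<1+n → ≤-<-trans (parent-mono 1≤i i≤i′ (≤-pred i′<1+n))

  parent<⇒≤#children< : ∀ {i j} → 1 ≤ i → i ≤ n → p i < j → i ≤ c j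
  parent<⇒≤#children< {i} {j} 1≤i i≤n pi<j =
    ≤-pred (proj₂ (∈-range⁻ 1 (c j) (subst (i ∈_) (parent<-prefix j)
      (∈-filter⁺ (λ i → p i <? j) (∈-range⁺ 1 n 1≤i (s≤s i≤n)) pi<j))))

  ≤#children<⇒parent< : ∀ {i j} → 1 ≤ i → i ≤ c j → p i < j
  ≤#children<⇒parent< {i} {j} 1≤i i≤cj = proj₂ (∈-filter⁻ (λ i → p i <? j) {xs = range 1 n}
    (subst (i ∈_) (sym (parent<-prefix j)) (∈-range⁺ 1 (c j) 1≤i (s≤s i≤cj))))

  #children<-mono : ∀ j → c j ≤ c (suc j)
  #children<-mono j = length-filter-mono _ _ (range 1 n) m<n⇒m<1+n

  #children<≤n : ∀ j → c j ≤ n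
  #children<≤n j = subst (c j ≤_) (length-range 1 n) (length-filter (λ i → p i <? j) (range 1 n))

  #children<-zero : c 0 ≡ 0
  #children<-zero = cong length (filter-none (λ i → p i <? 0) {xs = range 1 n} (All.tabulate λ _ ()))

  #children<-all : c (suc n) ≡ n
  #children<-all = trans (cong length (filter-all (λ i → p i <? suc n) (All.tabulate λ i∈ →
      let 1≤i , i<1+n = ∈-range⁻ 1 n i∈ in <-≤-trans (parent< 1≤i (≤-pred i<1+n)) (<⇒≤ i<1+n))))
    (length-range 1 n)

  ≤#children<-self : ∀ {j} → j ≤ n → j ≤ c j
  ≤#children<-self {zero}  _   = z≤n
  ≤#children<-self {suc j} j<n = parent<⇒≤#children< (s≤s z≤n) j<n (parent< (s≤s z≤n) j<n)

  #children<-last : c n ≡ n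
  #children<-last = ≤-antisym (#children<≤n n) (≤#children<-self ≤-refl)

  children-interval : ∀ j → childrenOf n p j ≡ reverse (range (suc (c j)) (c (suc j) ∸ c j))
  children-interval j = cong reverse (strictlySorted-≡ <-trans (<-irrefl refl)
      (Linked.filter⁺ (λ i → p i ≟ j) <-trans (range-↗ 1 n)) (range-↗ _ _) ⊆ ⊇)
    where
    end≡ : suc (c j) + (c (suc j) ∸ c j) ≡ suc (c (suc j))
    end≡ = cong suc (m+[n∸m]≡n (#children<-mono j))
    ⊆ : ∀ {i} → i ∈ filter (λ i → p i ≟ j) (range 1 n) → i ∈ range (suc (c j)) (c (suc j) ∸ c j)
    ⊆ {i} i∈ with i∈range , refl ← ∈-filter⁻ (λ i → p i ≟ j) {xs = range 1 n} i∈ =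
      let 1≤i , i<1+n = ∈-range⁻ 1 n i∈range in
      ∈-range⁺ (suc (c j)) _
        (≰⇒> λ i≤cj → <-irrefl refl (≤#children<⇒parent< 1≤i i≤cj))
        (subst (i <_) (sym end≡) (s≤s (parent<⇒≤#children< 1≤i (≤-pred i<1+n) ≤-refl)))
    ⊇ : ∀ {i} → i ∈ range (suc (c j)) (c (suc j) ∸ c j) → i ∈ filter (λ i → p i ≟ j) (range 1 n)
    ⊇ {i} i∈ =
      let cj<i , i<end = ∈-range⁻ (suc (c j)) _ i∈
          1≤i = ≤-trans (s≤s z≤n) cj<i
          i≤cj+1 = ≤-pred (subst (i <_) end≡ i<end)
      in ∈-filter⁺ (λ i → p i ≟ j) (∈-range⁺ 1 n 1≤i (s≤s (≤-trans i≤cj+1 (#children<≤n (suc j)))))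
           (≤-antisym (≤-pred (≤#children<⇒parent< 1≤i i≤cj+1))
                      (≮⇒≥ λ pi<j → <⇒≱ cj<i
                         (parent<⇒≤#children< 1≤i (≤-trans i≤cj+1 (#children<≤n (suc j))) pi<j)))

  children-above : ∀ {j x} → x ∈ childrenOf n p j → j < x × 1 ≤ x
  children-above {j} x∈ with x∈range , refl ← ∈-filter⁻ (λ i → p i ≟ j) {xs = range 1 n} (Any.reverse⁻ x∈) =
    let 1≤x , x<1+n = ∈-range⁻ 1 n x∈range in parent< 1≤x (≤-pred x<1+n) , 1≤x

  childrenOf-beyond : ∀ {j} → n ≤ j → childrenOf n p j ≡ []
  childrenOf-beyond {j} n≤j = cong reverse (filter-none (λ i → p i ≟ j) {xs = range 1 n} (All.tabulate λ i∈ pi≡j →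
    let 1≤i , i<1+n = ∈-range⁻ 1 n i∈ in
    <⇒≱ (<-≤-trans (parent< 1≤i (≤-pred i<1+n)) (≤-pred i<1+n)) (subst (n ≤_) (sym pi≡j) n≤j)))

  growTree-fuel : ∀ f j → n < f + j → growTree n p f j ≡ growTree n p (suc f) j
  growTree-fuel zero    j n<j = cong (node ∘ map (growTree n p zero)) (sym (childrenOf-beyond (<⇒≤ n<j)))
  growTree-fuel (suc f) j n<f+j = cong node (map-cong-local (All.tabulate λ x∈ →
    let j<x , _ = children-above x∈ in
    growTree-fuel f _ (<-≤-trans n<f+j (≤-trans (≤-reflexive (sym (+-suc f j))) (+-monoʳ-≤ f j<x)))))

  private
    subtree : ℕ → Tree
    subtree = growTree n p (suc n)

  growTree-unfold : ∀ j → subtree j ≡ node (map subtree (childrenOf n p j))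
  growTree-unfold j = cong node (map-cong-local (All.tabulate λ x∈ →
    growTree-fuel n _ (m<m+n n (proj₂ (children-above x∈)))))

  queue : ℕ → List Tree
  queue j = map subtree (range j (suc (c j) ∸ j))

  queue-zero : queue 0 ≡ subtree 0 ∷ []
  queue-zero = cong (λ k → map subtree (range 0 (suc k))) #children<-zero

  queue-last : queue n ≡ subtree n ∷ []
  queue-last = trans (cong (λ k → map subtree (range n (suc k ∸ n))) #children<-last)
                     (cong (map subtree ∘ range n) (trans (+-∸-assoc 1 {n} ≤-refl) (cong suc (n∸n≡0 n))))

  queue-suc : ∀ {j} → j ≤ n → bfsStep (queue j) ≡ queue (suc j)
  queue-suc {j} j≤n = begin
    bfsStep (map subtree (range j (suc (c j) ∸ j)))
      ≡⟨ cong (λ k → bfsStep (map subtree (range j k))) (+-∸-assoc 1 j≤cj) ⟩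
    bfsStep (subtree j ∷ old)
      ≡⟨ cong (λ t → bfsStep (t ∷ old)) (growTree-unfold j) ⟩
    old ++ reverse (map subtree (childrenOf n p j))
      ≡⟨ cong (λ cs → old ++ reverse (map subtree cs)) (children-interval j) ⟩
    old ++ reverse (map subtree (reverse new))
      ≡⟨ cong (λ cs → old ++ reverse cs) (reverse-map subtree new) ⟩
    old ++ reverse (reverse (map subtree new))
      ≡⟨ cong (old ++_) (reverse-involutive (map subtree new)) ⟩
    old ++ map subtree new
      ≡⟨ map-++ subtree (range (suc j) (c j ∸ j)) new ⟨
    map subtree (range (suc j) (c j ∸ j) ++ new)
      ≡⟨ cong (λ a → map subtree (range (suc j) (c j ∸ j) ++ range (suc a) (c (suc j) ∸ c j)))
              (m+[n∸m]≡n j≤cj) ⟨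
    map subtree (range (suc j) (c j ∸ j) ++ range (suc j + (c j ∸ j)) (c (suc j) ∸ c j))
      ≡⟨ cong (map subtree) (range-++ (suc j) (c j ∸ j) (c (suc j) ∸ c j)) ⟩
    map subtree (range (suc j) ((c j ∸ j) + (c (suc j) ∸ c j)))
      ≡⟨ cong (map subtree ∘ range (suc j)) lengths ⟩
    queue (suc j) ∎
    where
    open ≡-Reasoning
    j≤cj = ≤#children<-self j≤n
    old = map subtree (range (suc j) (c j ∸ j))
    new = range (suc (c j)) (c (suc j) ∸ c j)
    lengths : (c j ∸ j) + (c (suc j) ∸ c j) ≡ c (suc j) ∸ j
    lengths = trans (+-comm (c j ∸ j) _)
      (trans (sym (+-∸-assoc _ j≤cj)) (cong (_∸ j) (m∸n+n≡m (#children<-mono j))))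

  bfsQueue-growTree : ∀ {j} → j ≤ suc n → bfsQueue (subtree 0) j ≡ queue j
  bfsQueue-growTree {zero}  _       = sym queue-zero
  bfsQueue-growTree {suc j} (s≤s j≤n) = trans (cong bfsStep (bfsQueue-growTree (m≤n⇒m≤1+n j≤n))) (queue-suc j≤n)

  size-growTree : size (subtree 0) ≡ n
  size-growTree = suc-injective (begin
    suc (size (subtree 0))              ≡⟨ m∸n+n≡m n≤1+size ⟨
    suc (size (subtree 0)) ∸ n + n      ≡⟨ cong (_+ n) one ⟩
    suc n                               ∎)
    where
    open ≡-Reasoning
    one : suc (size (subtree 0)) ∸ n ≡ 1
    one = begin
      suc (size (subtree 0)) ∸ n                          ≡⟨ sizes-bfsQueue (subtree 0) n ⟨
      sizes (bfsQueue (subtree 0) n)                      ≡⟨ cong sizes (trans (bfsQueue-growTree (n≤1+n n)) queue-last) ⟩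
      sizes (subtree n ∷ [])                              ≡⟨ cong (λ t → sizes (t ∷ [])) (growTree-unfold n) ⟩
      sizes (node (map subtree (childrenOf n p n)) ∷ [])  ≡⟨ cong (λ cs → sizes (node (map subtree cs) ∷ []))
                                                                  (childrenOf-beyond ≤-refl) ⟩
      1                                                   ∎
    n≤1+size : n ≤ suc (size (subtree 0))
    n≤1+size = <⇒≤ (m∸n≢0⇒n<m {suc (size (subtree 0))} {n} λ eq → 0≢1+n (trans (sym eq) one))

  length-bfsQueue-growTree : ∀ {j} → j ≤ n → length (bfsQueue (subtree 0) j) + j ≡ suc (c j)
  length-bfsQueue-growTree {j} j≤n = begin
    length (bfsQueue (subtree 0) j) + j   ≡⟨ cong (λ q → length q + j) (bfsQueue-growTree (m≤n⇒m≤1+n j≤n)) ⟩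
    length (queue j) + j                  ≡⟨ cong (_+ j) (trans (length-map subtree (range j (suc (c j) ∸ j)))
                                                                (length-range j _)) ⟩
    suc (c j) ∸ j + j                     ≡⟨ m∸n+n≡m {suc (c j)} {j} (m≤n⇒m≤1+n (≤#children<-self j≤n)) ⟩
    suc (c j)                             ∎
    where open ≡-Reasoning

module _ {n p p′} (isP : IsParentMap n p) (isP′ : IsParentMap n p′) where
  private
    module T  = ParentMapTree isP
    module T′ = ParentMapTree isP′

  #children<-determines-parent : (∀ {j} → j ≤ suc n → #children< n p j ≡ #children< n p′ j) →
                                 ∀ {i} → 1 ≤ i → i ≤ n → p i ≡ p′ i
  #children<-determines-parent c≡c′ {i} 1≤i i≤n = ≤-antisym
    (≤-pred (T.≤#children<⇒parent< 1≤i (subst (i ≤_) (sym (c≡c′ (s≤s p′i≤n)))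
              (T′.parent<⇒≤#children< 1≤i i≤n ≤-refl))))
    (≤-pred (T′.≤#children<⇒parent< 1≤i (subst (i ≤_) (c≡c′ (s≤s pi≤n))
              (T.parent<⇒≤#children< 1≤i i≤n ≤-refl))))
    where
    pi≤n  = ≤-trans (<⇒≤ (IsParentMap.parent< isP 1≤i i≤n)) i≤n
    p′i≤n = ≤-trans (<⇒≤ (IsParentMap.parent< isP′ 1≤i i≤n)) i≤n

  growTree-injective : growTree n p (suc n) 0 ≡ growTree n p′ (suc n) 0 → ∀ {i} → 1 ≤ i → i ≤ n → p i ≡ p′ i
  growTree-injective t≡t′ = #children<-determines-parent c≡c′
    where
    c≡c′ : ∀ {j} → j ≤ suc n → #children< n p j ≡ #children< n p′ j
    c≡c′ {j} j≤1+n with m≤n⇒m<n∨m≡n j≤1+n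
    ... | inj₂ refl = trans T.#children<-all (sym T′.#children<-all)
    ... | inj₁ j<1+n = suc-injective (begin
      suc (#children< n p j)                              ≡⟨ T.length-bfsQueue-growTree (≤-pred j<1+n) ⟨
      length (bfsQueue (growTree n p (suc n) 0) j) + j    ≡⟨ cong (λ t → length (bfsQueue t j) + j) t≡t′ ⟩
      length (bfsQueue (growTree n p′ (suc n) 0) j) + j   ≡⟨ T′.length-bfsQueue-growTree (≤-pred j<1+n) ⟩
      suc (#children< n p′ j)                             ∎)
      where open ≡-Reasoning


-- Starting sets and Λ

x<x+1 : ∀ x → x ℚ.< x ℚ.+ 1ℚ
x<x+1 x = subst (ℚ._< x ℚ.+ 1ℚ) (ℚₚ.+-identityʳ x) (ℚₚ.+-monoʳ-< x (ℚₚ.positive⁻¹ 1ℚ))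

x-2+1<x : ∀ x → (x ℚ.- ℤ.+ 2 / 1) ℚ.+ 1ℚ ℚ.< x
x-2+1<x x = subst (ℚ._< x) (sym (ℚₚ.+-assoc x (ℚ.- (ℤ.+ 2 / 1)) 1ℚ))
  (subst (x ℚ.+ ℚ.- 1ℚ ℚ.<_) (ℚₚ.+-identityʳ x) (ℚₚ.+-monoʳ-< x (ℚₚ.negative⁻¹ (ℚ.- 1ℚ))))

nth-strictMono : ∀ {xs} → Linked ℚ._<_ xs → ∀ {a b} → a < b → b < length xs → nth xs a ℚ.< nth xs b
nth-strictMono {x ∷ y ∷ _} (x<y ∷ _)   {zero}  {suc zero}    _ _ = x<y
nth-strictMono {x ∷ y ∷ _} (x<y ∷ ys↗) {zero}  {suc (suc b)} _ (s≤s b<) =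
  ℚₚ.<-trans x<y (nth-strictMono ys↗ {0} {suc b} z<s b<)
nth-strictMono {x ∷ xs}    xs↗         {suc a} {suc b} (s≤s a<b) (s≤s b<) =
  nth-strictMono (Linked.tail xs↗) a<b b<
nth-strictMono {x ∷ []}    _           {zero}  {suc b} _ (s≤s ())

sorted-unique⇒strict : ∀ {xs} → Linked ℚ._≤_ xs → Unique xs → Linked ℚ._<_ xs
sorted-unique⇒strict []                         _            = []
sorted-unique⇒strict [-]                        _            = [-]
sorted-unique⇒strict (_∷_ {x} {y} x≤y ys↗) ((x≢y ∷ _) ∷ ys!) = x<y ∷ sorted-unique⇒strict ys↗ ys!
  where
  x<y : x ℚ.< y
  x<y with ℚₚ.<-cmp x y
  ... | tri< x<y _ _   = x<y
  ... | tri≈ _ x≡y _   = ⊥-elim (x≢y x≡y)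
  ... | tri> _ _ y<x   = ⊥-elim (ℚₚ.<-irrefl refl (ℚₚ.<-≤-trans y<x x≤y))

indexOf : ℚ → List ℚ → ℕ
indexOf y []       = 0
indexOf y (x ∷ xs) with x ℚₚ.≟ y
... | yes _ = 0
... | no  _ = suc (indexOf y xs)

indexOf-correct : ∀ {y} xs → y ∈ xs → indexOf y xs < length xs × nth xs (indexOf y xs) ≡ y
indexOf-correct {y} (x ∷ xs) y∈ with x ℚₚ.≟ y | y∈
... | yes x≡y | _         = z<s , x≡y
... | no  x≢y | here y≡x  = ⊥-elim (x≢y (sym y≡x))
... | no  _   | there y∈′ = let i< , nth≡ = indexOf-correct xs y∈′ in s≤s i< , nth≡

nth-∈ : ∀ (xs : List ℚ) {k} → k < length xs → nth xs k ∈ xs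
nth-∈ (x ∷ xs) {zero}  _        = here refl
nth-∈ (x ∷ xs) {suc k} (s≤s k<) = there (nth-∈ xs k<)

xval-strictMono : ∀ {S} → StartingSet S → ∀ {a b} → a < b → b ≤ length S → xval S a ℚ.< xval S b
xval-strictMono {x ∷ _} S↗ {zero}  {suc zero}    _ _ = ℚₚ.<-trans (x<x+1 _) (x-2+1<x x)
xval-strictMono {x ∷ _} S↗ {zero}  {suc (suc b)} _ b< =
  ℚₚ.<-trans (xval-strictMono S↗ {0} {1} z<s (s≤s z≤n)) (nth-strictMono S↗ {0} {suc b} z<s b<)
xval-strictMono         S↗ {suc a} {suc b} (s≤s a<b) b< = nth-strictMono S↗ a<b b<

Below : List ℚ → ℕ → ℕ → Set
Below S j i = xval S j ℚ.+ 1ℚ ℚ.< xval S i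

below-zero-one : ∀ {S} → 1 ≤ length S → Below S 0 1
below-zero-one {x ∷ _} _ = x-2+1<x x

buildFrom≡growTree : ∀ S f j → buildFrom S f j ≡ growTree (length S) (parentIdx S) f j
buildFrom≡growTree S zero    j = refl
buildFrom≡growTree S (suc f) j = cong node (trans (map-cong (buildFrom≡growTree S f) _)
  (cong (λ is → map (growTree (length S) (parentIdx S) f) (reverse (filter (λ i → parentIdx S i ≟ j) is)))
        (map-suc-upTo (length S))))

Strict : (S : List ℚ) → Fin (length S) → Fin (length S) → Set
Strict S i j = lookup S i ℚ.+ 1ℚ ℚ.< lookup S j

strict-irrefl : ∀ S i → ¬ Strict S i i
strict-irrefl S i = ℚₚ.<-asym (x<x+1 _)

lookup≡xval : ∀ S (i : Fin (length S)) → lookup S i ≡ xval S (suc (toℕ i))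
lookup≡xval (x ∷ S) Fin.zero    = refl
lookup≡xval (x ∷ S) (Fin.suc i) = lookup≡xval S i

module StartingSetParents {S : List ℚ} (S↗ : StartingSet S) where

  private
    n = length S

  xval-mono : ∀ {a b} → a ≤ b → b ≤ n → xval S a ℚ.≤ xval S b
  xval-mono a≤b b≤n with m≤n⇒m<n∨m≡n a≤b
  ... | inj₁ a<b  = ℚₚ.<⇒≤ (xval-strictMono S↗ a<b b≤n)
  ... | inj₂ refl = ℚₚ.≤-refl

  xval-reflects-< : ∀ {a b} → a ≤ n → xval S a ℚ.< xval S b → a < b
  xval-reflects-< {a} {b} a≤n xa<xb with <-cmp a b
  ... | tri< a<b _ _ = a<b
  ... | tri≈ _ refl _ = ⊥-elim (ℚₚ.<-irrefl refl xa<xb)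
  ... | tri> _ _ b<a = ⊥-elim (ℚₚ.<-asym xa<xb (xval-strictMono S↗ b<a a≤n))

  xval-injective : ∀ {a b} → a ≤ n → b ≤ n → xval S a ≡ xval S b → a ≡ b
  xval-injective {a} {b} a≤n b≤n xa≡xb with <-cmp a b
  ... | tri< a<b _ _ = ⊥-elim (ℚₚ.<-irrefl xa≡xb (xval-strictMono S↗ a<b b≤n))
  ... | tri≈ _ a≡b _ = a≡b
  ... | tri> _ _ b<a = ⊥-elim (ℚₚ.<-irrefl (sym xa≡xb) (xval-strictMono S↗ b<a a≤n))

  below-zero : ∀ {i} → 1 ≤ i → i ≤ n → Below S 0 i
  below-zero 1≤i i≤n = ℚₚ.<-≤-trans (below-zero-one {S} (≤-trans 1≤i i≤n)) (xval-mono 1≤i i≤n)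

  below-antitone : ∀ {j′ j i} → j′ ≤ j → j ≤ n → Below S j i → Below S j′ i
  below-antitone j′≤j j≤n = ℚₚ.≤-<-trans (ℚₚ.+-monoˡ-≤ 1ℚ (xval-mono j′≤j j≤n))

  below⇒< : ∀ {j i} → j ≤ n → Below S j i → j < i
  below⇒< j≤n xj+1<xi = xval-reflects-< j≤n (ℚₚ.<-trans (x<x+1 _) xj+1<xi)

  private
    below? : ∀ i j → Dec (Below S j i)
    below? i j = xval S j ℚ.+ 1ℚ ℚₚ.<? xval S i

  parentIdx-below : ∀ {i} → 1 ≤ i → i ≤ n → parentIdx S i ≤ n × Below S (parentIdx S i) i
  parentIdx-below {i} 1≤i i≤n = foldr-preservesᵇ {P = λ z → z ≤ n × Below S z i} ⊔-preserves
    (z≤n , below-zero 1≤i i≤n)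
    (All.tabulate λ j∈ → let j∈upTo , below = ∈-filter⁻ (below? i) {xs = upTo (suc n)} j∈
                         in ≤-pred (∈-upTo⁻ j∈upTo) , below)
    where
    ⊔-preserves : ∀ {x y} → x ≤ n × Below S x i → y ≤ n × Below S y i → x ⊔ y ≤ n × Below S (x ⊔ y) i
    ⊔-preserves {x} {y} px py = [ (λ eq → subst (λ z → z ≤ n × Below S z i) (sym eq) px)
                                , (λ eq → subst (λ z → z ≤ n × Below S z i) (sym eq) py) ]′ (⊔-sel x y)

  below⇒≤parentIdx : ∀ {j i} → j ≤ n → Below S j i → j ≤ parentIdx S i
  below⇒≤parentIdx {j} {i} j≤n below = foldr-preservesᵒ
    (λ x y → [ m≤n⇒m≤n⊔o y , m≤n⇒m≤o⊔n x ]′) 0 (filter (below? i) (upTo (suc n)))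
    (inj₂ (Any.map (λ { refl → ≤-refl }) (∈-filter⁺ (below? i) (∈-upTo⁺ (s≤s j≤n)) below)))

  ≤parentIdx⇒below : ∀ {j i} → 1 ≤ i → i ≤ n → j ≤ parentIdx S i → Below S j i
  ≤parentIdx⇒below {i = i} 1≤i i≤n j≤p =
    let p≤n , below = parentIdx-below 1≤i i≤n in below-antitone {i = i} j≤p p≤n below

  parentIdx-isParentMap : IsParentMap n (parentIdx S)
  parentIdx-isParentMap = record
    { parent<     = λ 1≤i i≤n → let p≤n , below = parentIdx-below 1≤i i≤n in below⇒< p≤n below
    ; parent-mono = λ {_} {i′} 1≤i i≤i′ i′≤n → let p≤n , below = parentIdx-below 1≤i (≤-trans i≤i′ i′≤n) in
        below⇒≤parentIdx {i = i′} p≤n (ℚₚ.<-≤-trans below (xval-mono i≤i′ i′≤n))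
    }

  parentIdx-unique : ∀ {i j} → 1 ≤ i → i ≤ n → j ≤ n → Below S j i → (suc j ≤ n → ¬ Below S (suc j) i) →
                     parentIdx S i ≡ j
  parentIdx-unique {i} 1≤i i≤n j≤n below not-below = ≤-antisym
    (≮⇒≥ λ j<p → not-below (≤-trans j<p (proj₁ (parentIdx-below 1≤i i≤n))) (≤parentIdx⇒below 1≤i i≤n j<p))
    (below⇒≤parentIdx {i = i} j≤n below)

  strict⇒≤parentIdx : ∀ {i j} → Strict S i j → suc (toℕ i) ≤ parentIdx S (suc (toℕ j))
  strict⇒≤parentIdx {i} {j} s = below⇒≤parentIdx {i = suc (toℕ j)} (Finₚ.toℕ<n i)
    (subst₂ (λ a b → a ℚ.+ 1ℚ ℚ.< b) (lookup≡xval S i) (lookup≡xval S j) s)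

  ≤parentIdx⇒strict : ∀ {i j} → suc (toℕ i) ≤ parentIdx S (suc (toℕ j)) → Strict S i j
  ≤parentIdx⇒strict {i} {j} le = subst₂ (λ a b → a ℚ.+ 1ℚ ℚ.< b) (sym (lookup≡xval S i)) (sym (lookup≡xval S j))
    (≤parentIdx⇒below (s≤s z≤n) (Finₚ.toℕ<n j) le)

  Λposet≡growTree : Λposet S ≡ growTree n (parentIdx S) (suc n) 0
  Λposet≡growTree = buildFrom≡growTree S (suc n) 0

  size-Λposet : size (Λposet S) ≡ n
  size-Λposet = trans (cong size Λposet≡growTree) (ParentMapTree.size-growTree parentIdx-isParentMap)

strict? : ∀ S i j → Dec (Strict S i j)
strict? S i j = lookup S i ℚ.+ 1ℚ ℚₚ.<? lookup S j

#strictlyBelow : (S : List ℚ) → Fin (length S) → ℕ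
#strictlyBelow S i = ∑[ j < length S ] indicator (strict? S j i)

parentIdx≡#strictlyBelow : ∀ {S} → StartingSet S → ∀ i → parentIdx S (suc (toℕ i)) ≡ #strictlyBelow S i
parentIdx≡#strictlyBelow {S} S↗ i = sym (begin
  #strictlyBelow S i
    ≡⟨ sum-cong-≗ {length S} (λ j → indicator-cong (strict? S j i) (toℕ j <? parentIdx S (suc (toℕ i)))
                                                   strict⇒≤parentIdx ≤parentIdx⇒strict) ⟩
  ∑[ j < length S ] indicator (toℕ j <? parentIdx S (suc (toℕ i)))
    ≡⟨ ∑-indicator-< (proj₁ (parentIdx-below (s≤s z≤n) (Finₚ.toℕ<n i))) ⟩
  parentIdx S (suc (toℕ i)) ∎)
  where
  open ≡-Reasoning
  open StartingSetParents S↗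

module PosetIsoInvariance {S S′ : List ℚ} (S↗ : StartingSet S) (S′↗ : StartingSet S′) (iso : PosetIso S S′) where

  private
    π = proj₁ iso
    to = Inverse.to π

  length≡ : length S ≡ length S′
  length≡ = Perm.↔⇒≡ π

  strict-preserved : ∀ i j → Strict S i j → Strict S′ (to i) (to j)
  strict-preserved i j s with proj₁ (proj₂ iso i j) (inj₂ s)
  ... | inj₂ s′    = s′
  ... | inj₁ πi≡πj = ⊥-elim (strict-irrefl S i (subst (Strict S i) (sym i≡j) s))
    where
    i≡j : i ≡ j
    i≡j = trans (sym (Perm.inverseˡ π)) (trans (cong (π Perm.⟨$⟩ˡ_) πi≡πj) (Perm.inverseˡ π))

  strict-reflected : ∀ i j → Strict S′ (to i) (to j) → Strict S i j
  strict-reflected i j s with proj₂ (proj₂ iso i j) (inj₂ s)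
  ... | inj₂ s′  = s′
  ... | inj₁ refl = ⊥-elim (strict-irrefl S′ (to i) s)

  parentIdx-preserved : ∀ i → parentIdx S (suc (toℕ i)) ≡ parentIdx S′ (suc (toℕ (to i)))
  parentIdx-preserved i = begin
    parentIdx S (suc (toℕ i))
      ≡⟨ parentIdx≡#strictlyBelow S↗ i ⟩
    #strictlyBelow S i
      ≡⟨ sum-cong-≗ {length S} (λ j → indicator-cong (strict? S j i) (strict? S′ (to j) (to i))
                                                     (strict-preserved j i) (strict-reflected j i)) ⟩
    ∑[ j < length S ] indicator (strict? S′ (to j) (to i))
      ≡⟨ ∑-permute (λ j → indicator (strict? S′ j (to i))) π ⟨
    #strictlyBelow S′ (to i)
      ≡⟨ parentIdx≡#strictlyBelow S′↗ (to i) ⟨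
    parentIdx S′ (suc (toℕ (to i))) ∎
    where open ≡-Reasoning

  #children<-preserved : ∀ v → #children< (length S) (parentIdx S) v ≡ #children< (length S′) (parentIdx S′) v
  #children<-preserved v = begin
    #children< (length S) (parentIdx S) v
      ≡⟨ length-filter-range≡∑ (λ i → parentIdx S i <? v) 1 (length S) ⟩
    ∑[ i < length S ] indicator (parentIdx S (suc (toℕ i)) <? v)
      ≡⟨ sum-cong-≗ {length S} (λ i → cong (λ k → indicator (k <? v)) (parentIdx-preserved i)) ⟩
    ∑[ i < length S ] indicator (parentIdx S′ (suc (toℕ (to i))) <? v)
      ≡⟨ ∑-permute (λ i → indicator (parentIdx S′ (suc (toℕ i)) <? v)) π ⟨
    ∑[ i < length S′ ] indicator (parentIdx S′ (suc (toℕ i)) <? v)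
      ≡⟨ length-filter-range≡∑ (λ i → parentIdx S′ i <? v) 1 (length S′) ⟨
    #children< (length S′) (parentIdx S′) v ∎
    where open ≡-Reasoning

  parentIdx-invariant : ∀ {i} → 1 ≤ i → i ≤ length S → parentIdx S i ≡ parentIdx S′ i
  parentIdx-invariant = #children<-determines-parent (StartingSetParents.parentIdx-isParentMap S↗) isParentMap′
    λ {v} _ → trans (#children<-preserved v) (cong (λ m → #children< m (parentIdx S′) v) (sym length≡))
    where
    isParentMap′ : IsParentMap (length S) (parentIdx S′)
    isParentMap′ = subst (λ m → IsParentMap m (parentIdx S′)) (sym length≡)
                         (StartingSetParents.parentIdx-isParentMap S′↗)

  Λposet-invariant : Λposet S ≡ Λposet S′
  Λposet-invariant = begin
    Λposet S                                                  ≡⟨ StartingSetParents.Λposet≡growTree S↗ ⟩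
    growTree (length S) (parentIdx S) (suc (length S)) 0      ≡⟨ growTree-cong parentIdx-invariant (suc (length S)) 0 ⟩
    growTree (length S) (parentIdx S′) (suc (length S)) 0     ≡⟨ cong (λ m → growTree m (parentIdx S′) (suc m) 0) length≡ ⟩
    growTree (length S′) (parentIdx S′) (suc (length S′)) 0   ≡⟨ StartingSetParents.Λposet≡growTree S′↗ ⟨
    Λposet S′                                                 ∎
    where open ≡-Reasoning

module _ {S₁ S₂ : List ℚ} (S₁↗ : StartingSet S₁) (S₂↗ : StartingSet S₂) where
  private
    module P₁ = StartingSetParents S₁↗
    module P₂ = StartingSetParents S₂↗

  sameParents⇒PosetIso : (e : length S₁ ≡ length S₂) →
    (∀ {i} → 1 ≤ i → i ≤ length S₁ → parentIdx S₁ i ≡ parentIdx S₂ i) → PosetIso S₁ S₂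
  sameParents⇒PosetIso e p₁≡p₂ = Perm.cast-id e , λ i j → prec⇒ i j , prec⇐ i j
    where
    index≡ : ∀ i → toℕ (Fin.cast e i) ≡ toℕ i
    index≡ = Finₚ.toℕ-cast e
    parent≡ : ∀ j → parentIdx S₁ (suc (toℕ j)) ≡ parentIdx S₂ (suc (toℕ (Fin.cast e j)))
    parent≡ j = trans (p₁≡p₂ (s≤s z≤n) (Finₚ.toℕ<n j)) (cong (parentIdx S₂ ∘ suc) (sym (index≡ j)))
    prec⇒ : ∀ i j → Prec S₁ i j → Prec S₂ (Fin.cast e i) (Fin.cast e j)
    prec⇒ i j (inj₁ refl) = inj₁ refl
    prec⇒ i j (inj₂ s)    = inj₂ (P₂.≤parentIdx⇒strict
      (subst₂ _≤_ (cong suc (sym (index≡ i))) (parent≡ j) (P₁.strict⇒≤parentIdx s)))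
    prec⇐ : ∀ i j → Prec S₂ (Fin.cast e i) (Fin.cast e j) → Prec S₁ i j
    prec⇐ i j (inj₁ eq) = inj₁ (Finₚ.toℕ-injective (trans (sym (index≡ i)) (trans (cong toℕ eq) (index≡ j))))
    prec⇐ i j (inj₂ s)  = inj₂ (P₁.≤parentIdx⇒strict
      (subst₂ _≤_ (cong suc (index≡ i)) (sym (parent≡ j)) (P₂.strict⇒≤parentIdx s)))

  Λposet-injective : Λposet S₁ ≡ Λposet S₂ → PosetIso S₁ S₂
  Λposet-injective Λ≡ = sameParents⇒PosetIso length≡
    (growTree-injective P₁.parentIdx-isParentMap isParentMap₂ growTree≡)
    where
    open ≡-Reasoning
    length≡ : length S₁ ≡ length S₂
    length≡ = trans (sym P₁.size-Λposet) (trans (cong size Λ≡) P₂.size-Λposet)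
    isParentMap₂ : IsParentMap (length S₁) (parentIdx S₂)
    isParentMap₂ = subst (λ m → IsParentMap m (parentIdx S₂)) (sym length≡) P₂.parentIdx-isParentMap
    growTree≡ : growTree (length S₁) (parentIdx S₁) (suc (length S₁)) 0
              ≡ growTree (length S₁) (parentIdx S₂) (suc (length S₁)) 0
    growTree≡ = begin
      growTree (length S₁) (parentIdx S₁) (suc (length S₁)) 0   ≡⟨ P₁.Λposet≡growTree ⟨
      Λposet S₁                                                 ≡⟨ Λ≡ ⟩
      Λposet S₂                                                 ≡⟨ P₂.Λposet≡growTree ⟩
      growTree (length S₂) (parentIdx S₂) (suc (length S₂)) 0   ≡⟨ cong (λ m → growTree m (parentIdx S₂) (suc m) 0) length≡ ⟨
      growTree (length S₁) (parentIdx S₂) (suc (length S₁)) 0   ∎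


-- The values of Ξ

ι : ℕ → ℚ
ι n = ℤ.+ n / 1

private
  toℚᵘ-ι : ∀ a b → toℚᵘ (ℤ.+ a / suc b) ℚᵘ.≃ mkℚᵘ (ℤ.+ a) b
  toℚᵘ-ι a b = ℚₚ.toℚᵘ-fromℚᵘ (mkℚᵘ (ℤ.+ a) b)

ι-homo-+ : ∀ a b → ι (a + b) ≡ ι a ℚ.+ ι b
ι-homo-+ a b = ℚₚ.toℚᵘ-injective (begin
  toℚᵘ (ι (a + b))                      ≈⟨ toℚᵘ-ι (a + b) 0 ⟩
  mkℚᵘ (ℤ.+ (a + b)) 0                  ≈⟨ *≡* (cong (ℤ._* ℤ.+ 1) (trans (ℤₚ.pos-+ a b) (sym (cong₂ ℤ._+_
                                              (ℤₚ.*-identityʳ (ℤ.+ a)) (ℤₚ.*-identityʳ (ℤ.+ b)))))) ⟩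
  mkℚᵘ (ℤ.+ a) 0 ℚᵘ.+ mkℚᵘ (ℤ.+ b) 0    ≈⟨ ℚᵘₚ.+-cong (toℚᵘ-ι a 0) (toℚᵘ-ι b 0) ⟨
  toℚᵘ (ι a) ℚᵘ.+ toℚᵘ (ι b)            ≈⟨ ℚₚ.toℚᵘ-homo-+ (ι a) (ι b) ⟨
  toℚᵘ (ι a ℚ.+ ι b)                    ∎)
  where open ℚᵘₚ.≃-Reasoning

ι-homo-* : ∀ a b → ι (a * b) ≡ ι a ℚ.* ι b
ι-homo-* a b = ℚₚ.toℚᵘ-injective (begin
  toℚᵘ (ι (a * b))                      ≈⟨ toℚᵘ-ι (a * b) 0 ⟩
  mkℚᵘ (ℤ.+ (a * b)) 0                  ≈⟨ *≡* (cong (ℤ._* ℤ.+ 1) (ℤₚ.pos-* a b)) ⟩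
  mkℚᵘ (ℤ.+ a) 0 ℚᵘ.* mkℚᵘ (ℤ.+ b) 0    ≈⟨ ℚᵘₚ.*-cong (toℚᵘ-ι a 0) (toℚᵘ-ι b 0) ⟨
  toℚᵘ (ι a) ℚᵘ.* toℚᵘ (ι b)            ≈⟨ ℚₚ.toℚᵘ-homo-* (ι a) (ι b) ⟨
  toℚᵘ (ι a ℚ.* ι b)                    ∎)
  where open ℚᵘₚ.≃-Reasoning

ι-mono-< : ∀ {a b} → a < b → ι a ℚ.< ι b
ι-mono-< {a} {b} a<b = ℚₚ.toℚᵘ-cancel-< (ℚᵘₚ.<-respʳ-≃ (ℚᵘₚ.≃-sym (toℚᵘ-ι b 0))
  (ℚᵘₚ.<-respˡ-≃ (ℚᵘₚ.≃-sym (toℚᵘ-ι a 0)) (*<* (ℤₚ.*-monoʳ-<-pos (ℤ.+ 1) (ℤ.+<+ a<b)))))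

ι-mono-≤ : ∀ {a b} → a ≤ b → ι a ℚ.≤ ι b
ι-mono-≤ a≤b with m≤n⇒m<n∨m≡n a≤b
... | inj₁ a<b  = ℚₚ.<⇒≤ (ι-mono-< a<b)
... | inj₂ refl = ℚₚ.≤-refl

Key : Set
Key = ℕ × ℕ

_⊏_ : Key → Key → Set
_⊏_ = ×-Lex _≡_ _<_ _<_

-- The node whose root path has right-to-left child positions c₁ … c_d gets the key (d , N) with
-- N = c₁ B ^ (d - 1) + … + c_d; its Ξ-value x_u is then d + N / B ^ d.
module Encoding (m : ℕ) where

  B : ℕ
  B = suc (suc m)

  w : ℚ
  w = ℤ.+ 1 / B

  B*w≡1 : ι B ℚ.* w ≡ 1ℚ
  B*w≡1 = ℚₚ.toℚᵘ-injective (begin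
    toℚᵘ (ι B ℚ.* w)                            ≈⟨ ℚₚ.toℚᵘ-homo-* (ι B) w ⟩
    toℚᵘ (ι B) ℚᵘ.* toℚᵘ w                      ≈⟨ ℚᵘₚ.*-cong (toℚᵘ-ι B 0) (toℚᵘ-ι 1 (suc m)) ⟩
    mkℚᵘ (ℤ.+ B) 0 ℚᵘ.* mkℚᵘ (ℤ.+ 1) (suc m)    ≈⟨ *≡* (trans (ℤₚ.*-identityʳ _) (trans (ℤₚ.*-identityʳ (ℤ.+ B))
                                                      (sym (trans (ℤₚ.*-identityˡ _) (cong ℤ.+_ (+-identityʳ B)))))) ⟩
    toℚᵘ 1ℚ                                     ∎)
    where open ℚᵘₚ.≃-Reasoning

  w^-positive : ∀ d → ℚ.Positive (powℚ w d)
  w^-positive zero    = _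
  w^-positive (suc d) = ℚₚ.pos*pos⇒pos w {{ℚₚ.normalize-pos 1 B}} (powℚ w d) {{w^-positive d}}

  w^*B^≡1 : ∀ d → powℚ w d ℚ.* ι (B ^ d) ≡ 1ℚ
  w^*B^≡1 zero    = refl
  w^*B^≡1 (suc d) = begin
    w ℚ.* powℚ w d ℚ.* ι (B * B ^ d)           ≡⟨ cong (w ℚ.* powℚ w d ℚ.*_) (ι-homo-* B (B ^ d)) ⟩
    w ℚ.* powℚ w d ℚ.* (ι B ℚ.* ι (B ^ d))     ≡⟨ solve 4 (λ a b c d → a :* b :* (c :* d) := (c :* a) :* (b :* d)) refl
                                                        w (powℚ w d) (ι B) (ι (B ^ d)) ⟩
    ι B ℚ.* w ℚ.* (powℚ w d ℚ.* ι (B ^ d))     ≡⟨ cong₂ ℚ._*_ B*w≡1 (w^*B^≡1 d) ⟩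
    1ℚ                                         ∎
    where
    open ≡-Reasoning
    open +-*-Solver

  ι-*B : ∀ N P → ι (N * B) ℚ.* (w ℚ.* P) ≡ ι N ℚ.* P
  ι-*B N P = begin
    ι (N * B) ℚ.* (w ℚ.* P)        ≡⟨ cong (ℚ._* (w ℚ.* P)) (ι-homo-* N B) ⟩
    ι N ℚ.* ι B ℚ.* (w ℚ.* P)      ≡⟨ ℚₚ.*-assoc (ι N) (ι B) (w ℚ.* P) ⟩
    ι N ℚ.* (ι B ℚ.* (w ℚ.* P))    ≡⟨ cong (ι N ℚ.*_) (ℚₚ.*-assoc (ι B) w P) ⟨
    ι N ℚ.* (ι B ℚ.* w ℚ.* P)      ≡⟨ cong (λ x → ι N ℚ.* (x ℚ.* P)) B*w≡1 ⟩
    ι N ℚ.* (1ℚ ℚ.* P)             ≡⟨ cong (ι N ℚ.*_) (ℚₚ.*-identityˡ P) ⟩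
    ι N ℚ.* P                      ∎
    where open ≡-Reasoning

  fraction : ℕ → ℕ → ℚ
  fraction d N = ι N ℚ.* powℚ w d

  fraction-child : ∀ d N k → fraction d N ℚ.+ ι k ℚ.* powℚ w (suc d) ≡ fraction (suc d) (N * B + k)
  fraction-child d N k = begin
    ι N ℚ.* P ℚ.+ ι k ℚ.* (w ℚ.* P)                  ≡⟨ cong (ℚ._+ ι k ℚ.* (w ℚ.* P)) (ι-*B N P) ⟨
    ι (N * B) ℚ.* (w ℚ.* P) ℚ.+ ι k ℚ.* (w ℚ.* P)    ≡⟨ ℚₚ.*-distribʳ-+ (w ℚ.* P) (ι (N * B)) (ι k) ⟨
    (ι (N * B) ℚ.+ ι k) ℚ.* (w ℚ.* P)                ≡⟨ cong (ℚ._* (w ℚ.* P)) (ι-homo-+ (N * B) k) ⟨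
    ι (N * B + k) ℚ.* (w ℚ.* P)                      ∎
    where
    open ≡-Reasoning
    P = powℚ w d

  fraction<1 : ∀ {d N} → N < B ^ d → fraction d N ℚ.< 1ℚ
  fraction<1 {d} {N} N<B^d = subst (fraction d N ℚ.<_) (trans (ℚₚ.*-comm (ι (B ^ d)) (powℚ w d)) (w^*B^≡1 d))
    (ℚₚ.*-monoˡ-<-pos (powℚ w d) {{w^-positive d}} (ι-mono-< N<B^d))

  fraction≥0 : ∀ d N → 0ℚ ℚ.≤ fraction d N
  fraction≥0 d N = subst (ℚ._≤ fraction d N) (ℚₚ.*-zeroˡ (powℚ w d))
    (ℚₚ.*-monoʳ-≤-nonNeg (powℚ w d) {{ℚₚ.pos⇒nonNeg (powℚ w d) {{w^-positive d}}}} (ι-mono-≤ {0} {N} z≤n))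

  xKey : Key → ℚ
  xKey (d , N) = ι d ℚ.+ fraction d N

  Valid : Key → Set
  Valid (d , N) = N < B ^ d

  xKey+1 : ∀ d N → xKey (d , N) ℚ.+ 1ℚ ≡ xKey (suc d , N * B)
  xKey+1 d N = begin
    ι d ℚ.+ ι N ℚ.* P ℚ.+ 1ℚ                 ≡⟨ ℚₚ.+-comm (ι d ℚ.+ ι N ℚ.* P) 1ℚ ⟩
    1ℚ ℚ.+ (ι d ℚ.+ ι N ℚ.* P)               ≡⟨ ℚₚ.+-assoc 1ℚ (ι d) (ι N ℚ.* P) ⟨
    1ℚ ℚ.+ ι d ℚ.+ ι N ℚ.* P                 ≡⟨ cong₂ ℚ._+_ (ι-homo-+ 1 d) (ι-*B N P) ⟨
    ι (suc d) ℚ.+ ι (N * B) ℚ.* (w ℚ.* P)    ∎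
    where
    open ≡-Reasoning
    P = powℚ w d

  xKey-strictMono : ∀ {κ κ′} → Valid κ → κ ⊏ κ′ → xKey κ ℚ.< xKey κ′
  xKey-strictMono {d , N} {d′ , N′} valid (inj₁ d<d′) = begin-strict
    ι d ℚ.+ fraction d N        <⟨ ℚₚ.+-monoʳ-< (ι d) (fraction<1 {d} valid) ⟩
    ι d ℚ.+ 1ℚ                  ≡⟨ trans (ℚₚ.+-comm (ι d) 1ℚ) (sym (ι-homo-+ 1 d)) ⟩
    ι (suc d)                   ≤⟨ ι-mono-≤ d<d′ ⟩
    ι d′                        ≡⟨ ℚₚ.+-identityʳ (ι d′) ⟨
    ι d′ ℚ.+ 0ℚ                 ≤⟨ ℚₚ.+-monoʳ-≤ (ι d′) (fraction≥0 d′ N′) ⟩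
    ι d′ ℚ.+ fraction d′ N′     ∎
    where open ℚₚ.≤-Reasoning
  xKey-strictMono {d , N} {.d , N′} valid (inj₂ (refl , N<N′)) =
    ℚₚ.+-monoʳ-< (ι d) (ℚₚ.*-monoˡ-<-pos (powℚ w d) {{w^-positive d}} (ι-mono-< N<N′))

  xKey-reflects-< : ∀ {κ κ′} → Valid κ → Valid κ′ → xKey κ ℚ.< xKey κ′ → κ ⊏ κ′
  xKey-reflects-< {κ} {κ′} valid valid′ x<x′ with ×-compare sym <-cmp <-cmp κ κ′
  ... | tri< κ⊏κ′ _ _          = κ⊏κ′
  ... | tri≈ _ (refl , refl) _ = ⊥-elim (ℚₚ.<-irrefl refl x<x′)
  ... | tri> _ _ κ′⊏κ          = ⊥-elim (ℚₚ.<-asym x<x′ (xKey-strictMono valid′ κ′⊏κ))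

  xKey-injective : ∀ {κ κ′} → Valid κ → Valid κ′ → xKey κ ≡ xKey κ′ → κ ≡ κ′
  xKey-injective {κ} {κ′} valid valid′ x≡x′ with ×-compare sym <-cmp <-cmp κ κ′
  ... | tri< κ⊏κ′ _ _          = ⊥-elim (ℚₚ.<-irrefl x≡x′ (xKey-strictMono valid κ⊏κ′))
  ... | tri≈ _ (refl , refl) _ = refl
  ... | tri> _ _ κ′⊏κ          = ⊥-elim (ℚₚ.<-irrefl (sym x≡x′) (xKey-strictMono valid′ κ′⊏κ))

  IsChildKey : Key → Key → Set
  IsChildKey (d , N) (d′ , M) = d′ ≡ suc d × N * B < M × M < N * B + B

  valid-shift : ∀ {d N} → Valid (d , N) → Valid (suc d , N * B)
  valid-shift {d} {N} N<B^d = subst (N * B <_) (*-comm (B ^ d) B) (*-monoˡ-< B N<B^d)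

  xKey+1<child : ∀ {κ κ′} → Valid κ → IsChildKey κ κ′ → xKey κ ℚ.+ 1ℚ ℚ.< xKey κ′
  xKey+1<child {d , N} {κ′} valid (refl , NB<M , _) = subst (ℚ._< xKey κ′) (sym (xKey+1 d N))
    (xKey-strictMono {suc d , N * B} (valid-shift {d} {N} valid) (inj₂ (refl , NB<M)))

  -- The children of κ = (d , N) have x-values in (x_κ + 1 , x_κ + 1 + B⁻ᵈ), whereas every key after κ
  -- has x-value at least x_κ + B⁻ᵈ.
  xKey+1≮child : ∀ {κ κ′ z} → Valid z → Valid κ′ → IsChildKey κ κ′ → κ ⊏ z → ¬ (xKey z ℚ.+ 1ℚ ℚ.< xKey κ′)
  xKey+1≮child {κ} {κ′} {dz , Nz} valid-z valid′ child κ⊏z xz+1<x′ = not-below child κ⊏z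
    (xKey-reflects-< {suc dz , Nz * B} (valid-shift {dz} {Nz} valid-z) valid′
      (subst (ℚ._< xKey κ′) (xKey+1 dz Nz) xz+1<x′))
    where
    not-below : ∀ {κ κ′ z} → IsChildKey κ κ′ → κ ⊏ z → ¬ ((suc (proj₁ z) , proj₂ z * B) ⊏ κ′)
    not-below (refl , _ , _) (inj₁ d<dz)       (inj₁ dz<d)       = <-asym d<dz (≤-pred dz<d)
    not-below (refl , _ , _) (inj₂ (refl , _)) (inj₁ d<d)        = <-irrefl refl (≤-pred d<d)
    not-below (refl , _ , _) (inj₁ d<dz)       (inj₂ (dz≡d , _)) = <-irrefl (sym (suc-injective dz≡d)) d<dz
    not-below {_ , N} {z = _ , Nz} (refl , _ , M<NB+B) (inj₂ (refl , N<Nz)) (inj₂ (_ , NzB<M)) =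
      <-asym NzB<M (<-≤-trans M<NB+B (subst (_≤ Nz * B) (+-comm B (N * B)) (*-monoˡ-≤ B N<Nz)))

module Blocks (m : ℕ) where
  open Encoding m

  -- (d′ , M) lies in the subtree of one of the depth-d keys (d , lo), …, (d , hi - 1).
  record InBlock (d lo hi : ℕ) (κ : Key) : Set where
    constructor inBlock
    field
      levels : ℕ
      depth≡ : proj₁ κ ≡ d + levels
      lower  : lo * B ^ levels ≤ proj₂ κ
      upper  : proj₂ κ < hi * B ^ levels

  inBlock-self : ∀ {d lo hi M} → lo ≤ M → M < hi → InBlock d lo hi (d , M)
  inBlock-self {d} {lo} {hi} {M} lo≤M M<hi =
    inBlock 0 (sym (+-identityʳ d)) (subst (_≤ M) (sym (*-identityʳ lo)) lo≤M)
              (subst (M <_) (sym (*-identityʳ hi)) M<hi)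

  inBlock-widen : ∀ {d lo lo′ hi hi′ κ} → lo′ ≤ lo → hi ≤ hi′ → InBlock d lo hi κ → InBlock d lo′ hi′ κ
  inBlock-widen lo′≤lo hi≤hi′ (inBlock e d≡ lo≤ <hi) =
    inBlock e d≡ (≤-trans (*-monoˡ-≤ (B ^ e) lo′≤lo) lo≤) (<-≤-trans <hi (*-monoˡ-≤ (B ^ e) hi≤hi′))

  inBlock-lift : ∀ {d N κ} → InBlock (suc d) (N * B) (N * B + B) κ → InBlock d N (suc N) κ
  inBlock-lift {d} {N} {d′ , M} (inBlock e d′≡ lo≤ <hi) = inBlock (suc e)
    (trans d′≡ (sym (+-suc d e)))
    (subst (_≤ M) (*-assoc N B (B ^ e)) lo≤)
    (subst (M <_) (trans (cong (_* B ^ e) (+-comm (N * B) B)) (*-assoc (suc N) B (B ^ e))) <hi)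

  inBlock-depth : ∀ {d lo hi κ} → InBlock d lo hi κ → d ≤ proj₁ κ
  inBlock-depth {d} (inBlock e d′≡ _ _) = subst (d ≤_) (sym d′≡) (m≤m+n d e)

  inBlock-disjoint : ∀ {d lo hi lo′ hi′ κ} → InBlock d lo hi κ → InBlock d lo′ hi′ κ → hi ≤ lo′ → ⊥
  inBlock-disjoint {d} (inBlock e d′≡ _ <hi) (inBlock e′ d′≡′ lo′≤ _) hi≤lo′
    with refl ← +-cancelˡ-≡ d e e′ (trans (sym d′≡) d′≡′) =
    <-irrefl refl (<-≤-trans <hi (≤-trans (*-monoˡ-≤ (B ^ e) hi≤lo′) lo′≤))

  inBlock-valid : ∀ {d N κ} → N < B ^ d → InBlock d N (suc N) κ → Valid κ
  inBlock-valid {d} {N} {d′ , M} N<B^d (inBlock e refl _ <hi) =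
    subst (M <_) (sym (^-distribˡ-+-* B d e)) (<-≤-trans <hi (*-monoˡ-≤ (B ^ e) N<B^d))

module Vertices (m : ℕ) where
  open Encoding m
  open Blocks m

  Fits : Tree → Set
  Fits t = maxArity t ≤ m

  fits-length : ∀ ts → Fits (node ts) → length ts ≤ m
  fits-length ts = m⊔n≤o⇒m≤o (length ts) (maxArities ts)

  fits-subtrees : ∀ ts → Fits (node ts) → maxArities ts ≤ m
  fits-subtrees ts = m⊔n≤o⇒n≤o (length ts) (maxArities ts)

  fits-head : ∀ t ts → maxArities (t ∷ ts) ≤ m → Fits t
  fits-head t ts = m⊔n≤o⇒m≤o (maxArity t) (maxArities ts)

  fits-tail : ∀ t ts → maxArities (t ∷ ts) ≤ m → maxArities ts ≤ m
  fits-tail t ts = m⊔n≤o⇒n≤o (maxArity t) (maxArities ts)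

  record Vertex : Set where
    constructor vertex
    field
      key       : Key
      childKeys : List Key
  open Vertex public

  -- As in Defs.xsList, k is the right-to-left position of the first tree of the list.
  childKeysFrom : ℕ → ℕ → ℕ → List Tree → List Key
  childKeysFrom d N k []       = []
  childKeysFrom d N k (t ∷ ts) = (suc d , N * B + k) ∷ childKeysFrom d N (k ∸ 1) ts

  vertexOf : ℕ → ℕ → Tree → Vertex
  vertexOf d N (node ts) = vertex (d , N) (childKeysFrom d N (length ts) ts)

  key-vertexOf : ∀ d N t → key (vertexOf d N t) ≡ (d , N)
  key-vertexOf d N (node ts) = refl

  mutual
    descendants : ℕ → ℕ → Tree → List Vertex
    descendants d N (node ts) = descendantsFrom d N (length ts) ts

    descendantsFrom : ℕ → ℕ → ℕ → List Tree → List Vertex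
    descendantsFrom d N k []       = []
    descendantsFrom d N k (t ∷ ts) =
      vertexOf (suc d) (N * B + k) t ∷ (descendants (suc d) (N * B + k) t ++ descendantsFrom d N (k ∸ 1) ts)

  vertices : ℕ → ℕ → Tree → List Vertex
  vertices d N t = vertexOf d N t ∷ descendants d N t

  mutual
    length-descendants : ∀ d N t → length (descendants d N t) ≡ size t
    length-descendants d N (node ts) = length-descendantsFrom d N (length ts) ts

    length-descendantsFrom : ∀ d N k ts → length (descendantsFrom d N k ts) ≡ sizes ts
    length-descendantsFrom d N k []       = refl
    length-descendantsFrom d N k (t ∷ ts) = cong suc (trans (length-++ (descendants (suc d) (N * B + k) t))
      (cong₂ _+_ (length-descendants (suc d) _ t) (length-descendantsFrom d N (k ∸ 1) ts)))

  module _ (Q : Vertex → Set) (Q-vertexOf : ∀ d N t → Fits t → Q (vertexOf d N t)) where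
    mutual
      all-descendants : ∀ d N t → Fits t → All Q (descendants d N t)
      all-descendants d N (node ts) fits = all-descendantsFrom d N (length ts) ts (fits-subtrees ts fits)

      all-descendantsFrom : ∀ d N k ts → maxArities ts ≤ m → All Q (descendantsFrom d N k ts)
      all-descendantsFrom d N k []       _    = All.[]
      all-descendantsFrom d N k (t ∷ ts) fits = Q-vertexOf (suc d) _ t (fits-head t ts fits) All.∷
        All.++⁺ (all-descendants (suc d) _ t (fits-head t ts fits))
                (all-descendantsFrom d N (k ∸ 1) ts (fits-tail t ts fits))

    all-vertices : ∀ d N t → Fits t → All Q (vertices d N t)
    all-vertices d N t fits = Q-vertexOf d N t fits All.∷ all-descendants d N t fits

  descendants-inBlock-widen : ∀ {d κ} N ts → Fits (node ts) →
    InBlock (suc d) (N * B) (N * B + suc (length ts)) κ → InBlock (suc d) (N * B) (N * B + B) κ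
  descendants-inBlock-widen N ts fits =
    inBlock-widen ≤-refl (+-monoʳ-≤ (N * B) (s≤s (m≤n⇒m≤1+n (fits-length ts fits))))

  descendantsFrom-inBlock : ∀ d N k ts → maxArities ts ≤ m → ∀ {v} → v ∈ descendantsFrom d N k ts →
                            InBlock (suc d) (N * B) (N * B + suc k) (key v)
  descendantsFrom-inBlock d N k (node us ∷ ts) fits v∈ with ∈-∷-++⁻ (descendants (suc d) (N * B + k) (node us)) v∈
  ... | inj₁ refl = inBlock-self (m≤m+n (N * B) k) (+-monoʳ-< (N * B) ≤-refl)
  ... | inj₂ (inj₁ v∈t) = inBlock-widen (m≤m+n (N * B) k) (≤-reflexive (sym (+-suc (N * B) k)))
        (inBlock-lift {N = N * B + k} (descendants-inBlock-widen (N * B + k) us (fits-head (node us) ts fits)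
          (descendantsFrom-inBlock (suc d) (N * B + k) (length us) us
            (fits-subtrees us (fits-head (node us) ts fits)) v∈t)))
  ... | inj₂ (inj₂ v∈ts) = inBlock-widen ≤-refl (+-monoʳ-≤ (N * B) (s≤s (m∸n≤m k 1)))
        (descendantsFrom-inBlock d N (k ∸ 1) ts (fits-tail (node us) ts fits) v∈ts)

  descendants-inBlock : ∀ d N t → Fits t → ∀ {v} → v ∈ descendants d N t →
                        InBlock (suc d) (N * B) (N * B + B) (key v)
  descendants-inBlock d N (node ts) fits v∈ =
    descendants-inBlock-widen N ts fits (descendantsFrom-inBlock d N (length ts) ts (fits-subtrees ts fits) v∈)

  descendants-valid : ∀ {d N t} → Fits t → N < B ^ d → ∀ {v} → v ∈ descendants d N t → Valid (key v)
  descendants-valid {d} {N} {t} fits N<B^d v∈ = inBlock-valid N<B^d (inBlock-lift (descendants-inBlock d N t fits v∈))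

  descendants-deeper : ∀ {d N t} → Fits t → ∀ {v} → v ∈ descendants d N t → d < proj₁ (key v)
  descendants-deeper {d} {N} {t} fits v∈ = inBlock-depth (descendants-inBlock d N t fits v∈)

  descendantsFrom-unique : ∀ d N k ts → length ts ≤ k → maxArities ts ≤ m →
                           Unique (map key (descendantsFrom d N k ts))
  descendantsFrom-unique d N k       []             _          _    = []
  descendantsFrom-unique d N (suc k) (node us ∷ ts) (s≤s len≤k) fits =
    subst (λ ks → Unique ((suc d , C) ∷ ks)) (sym (map-++ key subtree rest))
      (All.tabulate head-fresh ∷ Unique.++⁺
        (descendantsFrom-unique (suc d) C (length us) us ≤-refl (fits-subtrees us fits-us))
        (descendantsFrom-unique d N k ts len≤k (fits-tail (node us) ts fits))
        λ (κ∈subtree , κ∈rest) → inBlock-disjoint (rest-inBlock κ∈rest) (subtree-inBlock κ∈subtree) ≤-refl)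
    where
    C = N * B + suc k
    fits-us = fits-head (node us) ts fits
    subtree = descendants (suc d) C (node us)
    rest = descendantsFrom d N k ts
    subtree-inBlock : ∀ {κ} → κ ∈ map key subtree → InBlock (suc d) C (suc C) κ
    subtree-inBlock κ∈ with v , v∈ , refl ← find (Any.map⁻ κ∈) =
      inBlock-lift (descendants-inBlock (suc d) C (node us) fits-us v∈)
    rest-inBlock : ∀ {κ} → κ ∈ map key rest → InBlock (suc d) (N * B) C κ
    rest-inBlock κ∈ with v , v∈ , refl ← find (Any.map⁻ κ∈) =
      descendantsFrom-inBlock d N k ts (fits-tail (node us) ts fits) v∈
    subtree-deeper : ∀ {κ} → κ ∈ map key subtree → suc d < proj₁ κ
    subtree-deeper κ∈ with v , v∈ , refl ← find (Any.map⁻ κ∈) = descendants-deeper {t = node us} fits-us v∈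
    head-fresh : ∀ {κ} → κ ∈ map key subtree ++ map key rest → (suc d , C) ≢ κ
    head-fresh κ∈ refl with Any.++⁻ (map key subtree) κ∈
    ... | inj₁ κ∈subtree = <-irrefl refl (subtree-deeper κ∈subtree)
    ... | inj₂ κ∈rest    = inBlock-disjoint (rest-inBlock κ∈rest) (inBlock-self ≤-refl (n<1+n C)) ≤-refl

  descendants-unique : ∀ d N t → Fits t → Unique (map key (descendants d N t))
  descendants-unique d N (node ts) fits = descendantsFrom-unique d N (length ts) ts ≤-refl (fits-subtrees ts fits)

  childKeysFrom-children : ∀ d N k ts → length ts ≤ k → k ≤ m → All (IsChildKey (d , N)) (childKeysFrom d N k ts)
  childKeysFrom-children d N k       []       _           _   = All.[]
  childKeysFrom-children d N (suc k) (t ∷ ts) (s≤s len≤k) k<m =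
    (refl , m<m+n (N * B) z<s , +-monoʳ-< (N * B) (m≤n⇒m≤1+n (s≤s k<m))) All.∷
    childKeysFrom-children d N k ts len≤k (<⇒≤ k<m)

  childKeysFrom-decreasing : ∀ d N k ts → length ts ≤ k → Linked (flip _⊏_) (childKeysFrom d N k ts)
  childKeysFrom-decreasing d N k       []           _ = []
  childKeysFrom-decreasing d N k       (t ∷ [])     _ = [-]
  childKeysFrom-decreasing d N (suc k) (t ∷ t′ ∷ ts) (s≤s len≤k) =
    inj₂ (refl , +-monoʳ-< (N * B) (n<1+n k)) ∷ childKeysFrom-decreasing d N k (t′ ∷ ts) len≤k

  vertexOf-children : ∀ d N t → Fits t → All (IsChildKey (key (vertexOf d N t))) (childKeys (vertexOf d N t))
  vertexOf-children d N (node ts) fits = childKeysFrom-children d N (length ts) ts ≤-refl (fits-length ts fits)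

  vertexOf-decreasing : ∀ d N t → Linked (flip _⊏_) (childKeys (vertexOf d N t))
  vertexOf-decreasing d N (node ts) = childKeysFrom-decreasing d N (length ts) ts ≤-refl

  _∈ₖ_ : Key → List Vertex → Set
  κ ∈ₖ vs = Any (λ v → key v ≡ κ) vs

  childKeysFrom-∈ₖ : ∀ d N k ts {κ} → κ ∈ childKeysFrom d N k ts → κ ∈ₖ descendantsFrom d N k ts
  childKeysFrom-∈ₖ d N k (t ∷ ts) (here refl) = here (key-vertexOf (suc d) (N * B + k) t)
  childKeysFrom-∈ₖ d N k (t ∷ ts) (there κ∈)  =
    there (Any.++⁺ʳ (descendants (suc d) (N * B + k) t) (childKeysFrom-∈ₖ d N (k ∸ 1) ts κ∈))

  descendantsFrom-closed : ∀ d N k ts {v κ} → v ∈ descendantsFrom d N k ts → κ ∈ childKeys v →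
                           κ ∈ₖ descendantsFrom d N k ts
  descendantsFrom-closed d N k (node us ∷ ts) v∈ κ∈ with ∈-∷-++⁻ (descendants (suc d) (N * B + k) (node us)) v∈
  ... | inj₁ refl        = there (Any.++⁺ˡ (childKeysFrom-∈ₖ (suc d) (N * B + k) (length us) us κ∈))
  ... | inj₂ (inj₁ v∈t)  = there (Any.++⁺ˡ (descendantsFrom-closed (suc d) (N * B + k) (length us) us v∈t κ∈))
  ... | inj₂ (inj₂ v∈ts) = there (Any.++⁺ʳ (descendants (suc d) (N * B + k) (node us))
                                           (descendantsFrom-closed d N (k ∸ 1) ts v∈ts κ∈))

  vertices-closed : ∀ d N t {v κ} → v ∈ vertices d N t → κ ∈ childKeys v → κ ∈ₖ descendants d N t
  vertices-closed d N (node ts) (here refl) = childKeysFrom-∈ₖ d N (length ts) ts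
  vertices-closed d N (node ts) (there v∈)  = descendantsFrom-closed d N (length ts) ts v∈

  descendantsFrom-parent : ∀ d N k ts {v} → v ∈ descendantsFrom d N k ts →
    key v ∈ childKeysFrom d N k ts ⊎ ∃[ u ] (u ∈ descendantsFrom d N k ts × key v ∈ childKeys u)
  descendantsFrom-parent d N k (node us ∷ ts) v∈ with ∈-∷-++⁻ (descendants (suc d) (N * B + k) (node us)) v∈
  ... | inj₁ refl = inj₁ (here refl)
  ... | inj₂ (inj₁ v∈t) with descendantsFrom-parent (suc d) (N * B + k) (length us) us v∈t
  ...   | inj₁ κ∈             = inj₂ (_ , here refl , κ∈)
  ...   | inj₂ (u , u∈ , κ∈)  = inj₂ (u , there (∈-++⁺ˡ u∈) , κ∈)
  descendantsFrom-parent d N k (node us ∷ ts) v∈ | inj₂ (inj₂ v∈ts) with descendantsFrom-parent d N (k ∸ 1) ts v∈ts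
  ...   | inj₁ κ∈             = inj₁ (there κ∈)
  ...   | inj₂ (u , u∈ , κ∈)  =
    inj₂ (u , there (∈-++⁺ʳ (descendants (suc d) (N * B + k) (node us)) u∈) , κ∈)

  descendants-parent : ∀ d N t {v} → v ∈ descendants d N t → ∃[ u ] (u ∈ vertices d N t × key v ∈ childKeys u)
  descendants-parent d N (node ts) v∈ with descendantsFrom-parent d N (length ts) ts v∈
  ... | inj₁ κ∈            = vertexOf d N (node ts) , here refl , κ∈
  ... | inj₂ (u , u∈ , κ∈) = u , there u∈ , κ∈

  mutual
    xsNode≡ : ∀ d N s t → s ≡ fraction d N → xsNode w d s t ≡ map (xKey ∘ key) (descendants d N t)
    xsNode≡ d N s (node ts) s≡ = xsList≡ d N s (length ts) ts s≡

    xsList≡ : ∀ d N s k ts → s ≡ fraction d N → xsList w d s k ts ≡ map (xKey ∘ key) (descendantsFrom d N k ts)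
    xsList≡ d N s k []       s≡ = refl
    xsList≡ d N s k (t ∷ ts) s≡ = cong₂ _∷_
      (trans (cong (ι (suc d) ℚ.+_) s′≡) (cong xKey (sym (key-vertexOf (suc d) (N * B + k) t))))
      (trans (cong₂ _++_ (xsNode≡ (suc d) (N * B + k) s′ t s′≡) (xsList≡ d N s (k ∸ 1) ts s≡))
             (sym (map-++ (xKey ∘ key) (descendants (suc d) (N * B + k) t) (descendantsFrom d N (k ∸ 1) ts))))
      where
      s′ = s ℚ.+ ι k ℚ.* powℚ w (suc d)
      s′≡ : s′ ≡ fraction (suc d) (N * B + k)
      s′≡ = trans (cong (ℚ._+ ι k ℚ.* powℚ w (suc d)) s≡) (fraction-child d N k)


-- Λ ∘ Ξ

module ΞTree (T : Tree) where

  private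
    m = maxArity T
  open Encoding m
  open Vertices m

  private
    fits : Fits T
    fits = ≤-refl

    desc : List Vertex
    desc = descendants 0 0 T

    S : List ℚ
    S = Ξposet T

    S↭values : S ↭ map (xKey ∘ key) desc
    S↭values = subst (S ↭_) (xsNode≡ 0 0 0ℚ T refl) (sort-↭ (xsNode w 0 0ℚ T))

    desc-valid : ∀ {v} → v ∈ desc → Valid (key v)
    desc-valid = descendants-valid {0} {0} {T} fits (s≤s z≤n)

    desc-deeper : ∀ {v} → v ∈ desc → 0 < proj₁ (key v)
    desc-deeper = descendants-deeper {0} {0} {T} fits

  Ξposet-startingSet : StartingSet S
  Ξposet-startingSet = sorted-unique⇒strict (sort-↗ (xsNode w 0 0ℚ T))
    (Unique-resp-↭ (↭-sym S↭values) (subst Unique (sym (map-∘ desc))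
      (Unique-map⁺-on (All.map⁺ (All.tabulate desc-valid)) xKey-injective (descendants-unique 0 0 T fits))))

  length-Ξposet : length S ≡ size T
  length-Ξposet = trans (↭-length S↭values) (trans (length-map (xKey ∘ key) desc) (length-descendants 0 0 T))

  private
    IsNode : Key → Set
    IsNode κ = κ ∈ₖ desc

    isNode : ∀ {v} → v ∈ desc → IsNode (key v)
    isNode v∈ = lose v∈ refl

    node-valid : ∀ {κ} → IsNode κ → Valid κ
    node-valid κ∈ with v , v∈ , refl ← find κ∈ = desc-valid v∈

    node-deeper : ∀ {κ} → IsNode κ → 0 < proj₁ κ
    node-deeper κ∈ with v , v∈ , refl ← find κ∈ = desc-deeper v∈

    ∈S⁻ : ∀ {y} → y ∈ S → ∃[ v ] (v ∈ desc × xKey (key v) ≡ y)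
    ∈S⁻ y∈ with v , v∈ , y≡ ← find (Any.map⁻ (∈-resp-↭ S↭values y∈)) = v , v∈ , sym y≡

    ∈S⁺ : ∀ {κ} → IsNode κ → xKey κ ∈ S
    ∈S⁺ κ∈ with v , v∈ , refl ← find κ∈ = ∈-resp-↭ (↭-sym S↭values) (∈-map⁺ (xKey ∘ key) v∈)

  open StartingSetParents Ξposet-startingSet

  -- The index of the node with key κ in Ξposet T, the root being v₀.
  label : Key → ℕ
  label (zero  , _) = 0
  label (suc d , M) = suc (indexOf (xKey (suc d , M)) S)

  private
    label-spec : ∀ {κ} → IsNode κ → 1 ≤ label κ × label κ ≤ length S × xval S (label κ) ≡ xKey κ
    label-spec {zero  , _} κ∈ = ⊥-elim (<-irrefl refl (node-deeper κ∈))
    label-spec {suc d , M} κ∈ = let i< , nth≡ = indexOf-correct S (∈S⁺ κ∈) in s≤s z≤n , i< , nth≡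

  label-pos : ∀ {κ} → IsNode κ → 1 ≤ label κ
  label-pos = proj₁ ∘ label-spec

  label≤n : ∀ {κ} → IsNode κ → label κ ≤ length S
  label≤n = proj₁ ∘ proj₂ ∘ label-spec

  xval-label : ∀ {κ} → IsNode κ → xval S (label κ) ≡ xKey κ
  xval-label = proj₂ ∘ proj₂ ∘ label-spec

  label-surjective : ∀ {i} → 1 ≤ i → i ≤ length S → ∃[ v ] (v ∈ desc × label (key v) ≡ i)
  label-surjective {suc k} _ k<n = from-value (∈S⁻ (nth-∈ S k<n))
    where
    from-value : ∃[ v ] (v ∈ desc × xKey (key v) ≡ nth S k) → ∃[ v ] (v ∈ desc × label (key v) ≡ suc k)
    from-value (v , v∈ , x≡) =
      v , v∈ , xval-injective (label≤n (isNode v∈)) k<n (trans (xval-label (isNode v∈)) x≡)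

  label-strictMono : ∀ {κ κ′} → IsNode κ → IsNode κ′ → κ ⊏ κ′ → label κ < label κ′
  label-strictMono {κ} κ∈ κ′∈ κ⊏κ′ = xval-reflects-< (label≤n κ∈)
    (subst₂ ℚ._<_ (sym (xval-label κ∈)) (sym (xval-label κ′∈)) (xKey-strictMono {κ} (node-valid κ∈) κ⊏κ′))

  -- The candidate j lies below the child, and the element of S after x_j is the value of a key after the
  -- parent, which does not.
  parentIdx-label : ∀ {κ κ′ j} → IsChildKey κ κ′ → IsNode κ′ → j ≤ length S → Below S j (label κ′) →
    (∀ {z} → z ∈ desc → suc j ≤ length S → xval S (suc j) ≡ xKey (key z) → κ ⊏ key z) →
    parentIdx S (label κ′) ≡ j
  parentIdx-label {κ} {κ′} {j} child κ′∈ₖ j≤n below after =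
    parentIdx-unique (label-pos κ′∈ₖ) (label≤n κ′∈ₖ) j≤n below λ j<n → not-below j<n (∈S⁻ (nth-∈ S j<n))
    where
    not-below : suc j ≤ length S → ∃[ z ] (z ∈ desc × xKey (key z) ≡ nth S j) → ¬ Below S (suc j) (label κ′)
    not-below j<n (z , z∈ , x≡) = xKey+1≮child {κ} {κ′} {key z} (desc-valid z∈) (node-valid κ′∈ₖ) child
      (after z∈ j<n (sym x≡)) ∘ subst₂ (λ a b → a ℚ.+ 1ℚ ℚ.< b) (sym x≡) (xval-label κ′∈ₖ)

  private
    vertices₀ : List Vertex
    vertices₀ = vertices 0 0 T

    vertices-children : ∀ {u} → u ∈ vertices₀ → All (IsChildKey (key u)) (childKeys u)
    vertices-children = All.lookup
      (all-vertices (λ u → All (IsChildKey (key u)) (childKeys u)) vertexOf-children 0 0 T fits)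

    vertices-decreasing : ∀ {u} → u ∈ vertices₀ → Linked (flip _⊏_) (childKeys u)
    vertices-decreasing = All.lookup (all-vertices (λ u → Linked (flip _⊏_) (childKeys u))
                                                   (λ d N t _ → vertexOf-decreasing d N t) 0 0 T fits)

    label-root : label (key (vertexOf 0 0 T)) ≡ 0
    label-root = cong label (key-vertexOf 0 0 T)

  parentIdx-child : ∀ {u κ′} → u ∈ vertices₀ → κ′ ∈ childKeys u → parentIdx S (label κ′) ≡ label (key u)
  parentIdx-child {u} {κ′} (here refl) κ′∈ = trans
    (parentIdx-label (All.lookup (vertices-children (here refl)) κ′∈) κ′∈ₖ z≤n
       (below-zero (label-pos κ′∈ₖ) (label≤n κ′∈ₖ))
       λ z∈ _ _ → subst (_⊏ _) (sym (key-vertexOf 0 0 T)) (inj₁ (desc-deeper z∈)))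
    (sym label-root)
    where
    κ′∈ₖ = vertices-closed 0 0 T (here refl) κ′∈
  parentIdx-child {u} {κ′} (there u∈) κ′∈ = parentIdx-label child κ′∈ₖ (label≤n u∈ₖ) below after
    where
    u∈ₖ = isNode u∈
    κ′∈ₖ = vertices-closed 0 0 T (there u∈) κ′∈
    child = All.lookup (vertices-children (there u∈)) κ′∈
    below : Below S (label (key u)) (label κ′)
    below = subst₂ (λ a b → a ℚ.+ 1ℚ ℚ.< b) (sym (xval-label u∈ₖ)) (sym (xval-label κ′∈ₖ))
      (xKey+1<child {key u} (desc-valid u∈) child)
    after : ∀ {z} → z ∈ desc → suc (label (key u)) ≤ length S → xval S (suc (label (key u))) ≡ xKey (key z) →
            key u ⊏ key z
    after {z} z∈ j<n x≡ = xKey-reflects-< {key u} {key z} (desc-valid u∈) (desc-valid z∈)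
      (subst₂ ℚ._<_ (xval-label u∈ₖ) x≡ (xval-strictMono Ξposet-startingSet (n<1+n _) j<n))

  private
    vertices-unique : Unique (map key vertices₀)
    vertices-unique = All.tabulate root-fresh ∷ descendants-unique 0 0 T fits
      where
      root-fresh : ∀ {κ} → κ ∈ map key desc → key (vertexOf 0 0 T) ≢ κ
      root-fresh κ∈ root≡κ with v , v∈ , refl ← find (Any.map⁻ κ∈) =
        <-irrefl (cong proj₁ (trans (sym (key-vertexOf 0 0 T)) root≡κ)) (desc-deeper v∈)

  label-injective : ∀ {u u′} → u ∈ vertices₀ → u′ ∈ vertices₀ → label (key u) ≡ label (key u′) → u ≡ u′
  label-injective u∈ u′∈ l≡ = Unique-map-injective key vertices-unique u∈ u′∈ (keys≡ u∈ u′∈ l≡)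
    where
    keys≡ : ∀ {u u′} → u ∈ vertices₀ → u′ ∈ vertices₀ → label (key u) ≡ label (key u′) → key u ≡ key u′
    keys≡ (here refl) (here refl) _  = refl
    keys≡ (here refl) (there v′∈) l≡ =
      ⊥-elim (1+n≰n (subst (1 ≤_) (trans (sym l≡) label-root) (label-pos (isNode v′∈))))
    keys≡ (there v∈)  (here refl) l≡ =
      ⊥-elim (1+n≰n (subst (1 ≤_) (trans l≡ label-root) (label-pos (isNode v∈))))
    keys≡ (there v∈)  (there v′∈) l≡ = xKey-injective (desc-valid v∈) (desc-valid v′∈)
      (trans (sym (xval-label (isNode v∈))) (trans (cong (xval S) l≡) (xval-label (isNode v′∈))))

  childrenOf-label : ∀ {u} → u ∈ vertices₀ →
                     childrenOf (length S) (parentIdx S) (label (key u)) ≡ map label (childKeys u)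
  childrenOf-label {u} u∈ = begin
    reverse (filter (λ i → parentIdx S i ≟ j) (range 1 n))
      ≡⟨ cong reverse (strictlySorted-≡ <-trans (<-irrefl refl) children↗ increasing ⊆ ⊇) ⟩
    reverse (reverse (map label (childKeys u)))
      ≡⟨ reverse-involutive (map label (childKeys u)) ⟩
    map label (childKeys u) ∎
    where
    open ≡-Reasoning
    n = length S
    j = label (key u)
    children↗ : Linked _<_ (filter (λ i → parentIdx S i ≟ j) (range 1 n))
    children↗ = Linked.filter⁺ (λ i → parentIdx S i ≟ j) <-trans (range-↗ 1 n)
    child∈ₖ : ∀ {κ} → κ ∈ childKeys u → IsNode κ
    child∈ₖ = vertices-closed 0 0 T u∈
    increasing : Linked _<_ (reverse (map label (childKeys u)))
    increasing = Linked-reverse (λ a b → <-trans b a)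
      (Linked-map⁺-on (All.tabulate child∈ₖ) (λ n₁ n₂ κ₂⊏κ₁ → label-strictMono n₂ n₁ κ₂⊏κ₁) (vertices-decreasing u∈))
    child-of-u : ∀ {v} → v ∈ desc → parentIdx S (label (key v)) ≡ j → key v ∈ childKeys u
    child-of-u {v} v∈ p≡j = from-parent (descendants-parent 0 0 T v∈)
      where
      from-parent : ∃[ u′ ] (u′ ∈ vertices₀ × key v ∈ childKeys u′) → key v ∈ childKeys u
      from-parent (u′ , u′∈ , κ∈) =
        subst (λ u″ → key v ∈ childKeys u″) (label-injective u′∈ u∈ (trans (sym (parentIdx-child u′∈ κ∈)) p≡j)) κ∈
    ⊆ : ∀ {i} → i ∈ filter (λ i → parentIdx S i ≟ j) (range 1 n) → i ∈ reverse (map label (childKeys u))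
    ⊆ {i} i∈ = from-vertex (label-surjective 1≤i (≤-pred i<1+n))
      where
      i∈range = proj₁ (∈-filter⁻ (λ i → parentIdx S i ≟ j) {xs = range 1 n} i∈)
      p≡j = proj₂ (∈-filter⁻ (λ i → parentIdx S i ≟ j) {xs = range 1 n} i∈)
      1≤i = proj₁ (∈-range⁻ 1 n i∈range)
      i<1+n = proj₂ (∈-range⁻ 1 n i∈range)
      from-vertex : ∃[ v ] (v ∈ desc × label (key v) ≡ i) → i ∈ reverse (map label (childKeys u))
      from-vertex (v , v∈ , refl) = Any.reverse⁺ (∈-map⁺ label (child-of-u v∈ p≡j))
    ⊇ : ∀ {i} → i ∈ reverse (map label (childKeys u)) → i ∈ filter (λ i → parentIdx S i ≟ j) (range 1 n)
    ⊇ {i} i∈ = from-key (∈-map⁻ label (Any.reverse⁻ i∈))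
      where
      from-key : ∃[ κ ] (κ ∈ childKeys u × i ≡ label κ) → i ∈ filter (λ i → parentIdx S i ≟ j) (range 1 n)
      from-key (κ , κ∈ , refl) = ∈-filter⁺ (λ i → parentIdx S i ≟ j)
        (∈-range⁺ 1 n (label-pos (child∈ₖ κ∈)) (s≤s (label≤n (child∈ₖ κ∈)))) (parentIdx-child u∈ κ∈)

  mutual
    growTree-label : ∀ f d N t → vertexOf d N t ∈ vertices₀ → (∀ {v} → v ∈ descendants d N t → v ∈ vertices₀) →
                     size t < f → growTree (length S) (parentIdx S) f (label (d , N)) ≡ t
    growTree-label (suc f) d N (node ts) u∈ sub (s≤s size≤f) = cong node (begin
      map (growTree (length S) (parentIdx S) f) (childrenOf (length S) (parentIdx S) (label (d , N)))
        ≡⟨ cong (map (growTree (length S) (parentIdx S) f)) (childrenOf-label u∈) ⟩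
      map (growTree (length S) (parentIdx S) f) (map label (childKeysFrom d N (length ts) ts))
        ≡⟨ map-∘ (childKeysFrom d N (length ts) ts) ⟨
      map (growTree (length S) (parentIdx S) f ∘ label) (childKeysFrom d N (length ts) ts)
        ≡⟨ growTree-labels f d N (length ts) ts sub size≤f ⟩
      ts ∎)
      where open ≡-Reasoning

    growTree-labels : ∀ f d N k ts → (∀ {v} → v ∈ descendantsFrom d N k ts → v ∈ vertices₀) → sizes ts ≤ f →
                      map (growTree (length S) (parentIdx S) f ∘ label) (childKeysFrom d N k ts) ≡ ts
    growTree-labels f d N k []       sub _        = refl
    growTree-labels f d N k (t ∷ ts) sub sizes≤f = cong₂ _∷_
      (growTree-label f (suc d) (N * B + k) t (sub (here refl)) (sub ∘ there ∘ ∈-++⁺ˡ)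
        (≤-trans (m≤m+n (suc (size t)) (sizes ts)) sizes≤f))
      (growTree-labels f d N (k ∸ 1) ts (sub ∘ there ∘ ∈-++⁺ʳ (descendants (suc d) (N * B + k) t))
        (≤-trans (m≤n+m (sizes ts) (suc (size t))) sizes≤f))

  Λposet∘Ξposet : Λposet S ≡ T
  Λposet∘Ξposet = trans Λposet≡growTree
    (growTree-label (suc (length S)) 0 0 T (here refl) there (s≤s (≤-reflexive (sym length-Ξposet))))

proposition3p4 : ∀ (n : ℕ) → 1 ≤ n →
    -- Λ_poset is well defined on 𝒫_n (depends only on the poset up to isomorphism)
    (∀ (S S' : List ℚ) → StartingSet S → StartingSet S' →
       length S ≡ n → length S' ≡ n → PosetIso S S' → Λposet S ≡ Λposet S')
    -- Λ_poset maps 𝒫_n into 𝒯_n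
  × (∀ (S : List ℚ) → StartingSet S → length S ≡ n → size (Λposet S) ≡ n)
    -- Ξ_poset maps 𝒯_n into 𝒫_n, and Λ_poset ∘ Ξ_poset = id on 𝒯_n
  × (∀ (T : Tree) → size T ≡ n →
       StartingSet (Ξposet T) × length (Ξposet T) ≡ n × Λposet (Ξposet T) ≡ T)
    -- Ξ_poset ∘ Λ_poset = id on 𝒫_n (up to poset isomorphism)
  × (∀ (S : List ℚ) → StartingSet S → length S ≡ n → PosetIso (Ξposet (Λposet S)) S)
proposition3p4 n _ =
    (λ S S′ S↗ S′↗ _ _ iso → PosetIsoInvariance.Λposet-invariant S↗ S′↗ iso)
  , (λ S S↗ length≡n → trans (StartingSetParents.size-Λposet S↗) length≡n)
  , (λ T size≡n → ΞTree.Ξposet-startingSet T , trans (ΞTree.length-Ξposet T) size≡n , ΞTree.Λposet∘Ξposet T)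
  , λ S S↗ _ → Λposet-injective (ΞTree.Ξposet-startingSet (Λposet S)) S↗ (ΞTree.Λposet∘Ξposet (Λposet S))
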